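{- Let $p_1,p_2\ge 0$ with $p_1+p_2\le 1$. For every $n\ge 1$, the expected value of the subtree number index of the random polyphenylene chain $RPC(n,p_1,p_2)$ is \[ E(STN(RPC(n,p_1,p_2)))=\frac{441}{(11+4p_1+p_2)^2}(12+4p_1+p_2)^n+\frac{144p_1+36p_2-45}{11+4p_1+p_2}\,n-\frac{441}{(11+4p_1+p_2)^2}. \]
   Context: For a simple graph $G$, the subtree number index $STN(G)$ is the number of nonempty subtrees of $G$, i.e. of subgraphs of $G$ that are trees (single vertices included). A polyphenylene chain with $n$ hexagons consists of $n$ vertex-disjoint hexagons (6-cycles) $H_1,\dots,H_n$ together with, for each $i=1,\dots,n-1$, one edge (a cut edge) joining a vertex of $H_i$ to a vertex of $H_{i+1}$, the vertex of $H_i$ used for $H_{i-1}$ being different from the vertex used for $H_{i+1}$. For $2\le i\le n-1$, let $d_i\in\{1,2,3\}$ be the distance within $H_i$ between the vertex of $H_i$ incident to the cut edge to $H_{i-1}$ and the vertex of $H_i$ incident to the cut edge to $H_{i+1}$ ($d_i=1$: ortho, $d_i=2$: meta, $d_i=3$: para); up to isomorphism the chain is determined by $(d_2,\dots,d_{n-1})$ (for $n=1,2$ the chain is unique). The random polyphenylene chain $RPC(n,p_1,p_2)$ is obtained by stepwise addition of terminal hexagons, where at each step $i=3,\dots,n$ the new hexagon $H_i$ is attached so that, independently of the other steps, $d_{i-1}=1$ with probability $p_1$, $d_{i-1}=2$ with probability $p_2$, and $d_{i-1}=3$ with probability $1-p_1-p_2$.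
   Formalization: The probabilities p₁ and p₂ of the random polyphenylene chain take rational values. -}

module Defs where

open import Data.Nat as ℕ using (ℕ; zero; suc; _∸_)
open import Data.Integer using (+_)
open import Data.Rational using (ℚ; _+_; _*_; _-_; _≤_; _/_; 0ℚ; 1ℚ; NonZero; Positive; NonNegative; nonNegative)
open import Data.Rational.Properties
  using (pos⇒nonZero; pos+nonNeg⇒pos; pos*pos⇒pos; nonNeg*nonNeg⇒nonNeg)
import Data.Rational.Literals as QLit
import Data.Nat.Literals
open import Data.Unit using (⊤; tt)
open import Agda.Builtin.FromNat using (Number; fromNat) public
open import Agda.Builtin.FromNeg using (fromNeg) public
open import Data.Fin using (Fin)
open import Data.Fin.Subset using (Subset; _∈_)
open import Data.List using (List; []; _∷_; _++_; length; lookup; map; concatMap; upTo)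
open import Data.List.Relation.Unary.Linked using (Linked)
open import Data.List.Relation.Unary.Unique.Propositional using (Unique)
open import Data.Vec using (Vec; []; _∷_; toList)
open import Data.Product using (Σ; ∃; _×_; _,_; proj₁; proj₂)
open import Data.Sum using (_⊎_)
open import Relation.Nullary using (¬_)
open import Relation.Binary.PropositionalEquality using (_≡_)
open import Relation.Binary.Construct.Closure.ReflexiveTransitive using (Star)
open import Function.Bundles using (_↔_)

instance
  ℚ-number = QLit.number
  ℚ-negative = QLit.negative
  ℕ-number = Data.Nat.Literals.number
  ⊤-inst : ⊤
  ⊤-inst = tt

ℕtoℚ : ℕ → ℚ
ℕtoℚ n = (+ n) / 1

_^ℚ_ : ℚ → ℕ → ℚ
p ^ℚ zero = 1ℚ
p ^ℚ suc n = p * (p ^ℚ n)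

-- Simple graphs: vertices are 0 … V-1 (as Fin V); the edge set is given
-- as a duplicate-free list of unordered pairs (stored as ordered pairs
-- of vertex labels in ℕ; each edge listed once).

record Graph : Set where
  field
    V : ℕ
    E : List (ℕ × ℕ)

open Graph public

module _ (G : Graph) (S : Subset (V G)) (F : Subset (length (E G))) where

  InS : ℕ → Set
  InS a = Σ (Fin (V G)) λ i → Data.Fin.toℕ i ≡ a × i ∈ S

  AdjF : ℕ → ℕ → Set
  AdjF u v = ∃ λ (e : Fin (length (E G))) →
    e ∈ F × (lookup (E G) e ≡ (u , v) ⊎ lookup (E G) e ≡ (v , u))

  record IsTree : Set where
    field
      nonempty  : ∃ λ i → i ∈ S
      closed    : ∀ e → e ∈ F → InS (proj₁ (lookup (E G) e)) × InS (proj₂ (lookup (E G) e))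
      connected : ∀ u v → InS u → InS v → Star AdjF u v
      acyclic   : ∀ (x : ℕ) (xs : List ℕ) → 3 ℕ.≤ length (x ∷ xs) → Unique (x ∷ xs) →
                  ¬ Linked AdjF ((x ∷ xs) ++ (x ∷ []))

-- A subtree of G: a vertex subset and an edge subset forming a tree.
-- The tree proof is irrelevant, so subtrees are equal iff they have the
-- same vertices and edges.
record Subtree (G : Graph) : Set where
  constructor subtree
  field
    vset    : Subset (V G)
    eset    : Subset (length (E G))
    .isTree : IsTree G vset eset

HasSTN : Graph → ℕ → Set
HasSTN G k = Fin k ↔ Subtree G

data Dist : Set where
  ortho meta para : Dist

distℕ : Dist → ℕ
distℕ ortho = 1
distℕ meta  = 2
distℕ para  = 3

hexEdges : ℕ → List (ℕ × ℕ)
hexEdges i = (b ℕ.+ 0 , b ℕ.+ 1) ∷ (b ℕ.+ 1 , b ℕ.+ 2) ∷ (b ℕ.+ 2 , b ℕ.+ 3) ∷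
             (b ℕ.+ 3 , b ℕ.+ 4) ∷ (b ℕ.+ 4 , b ℕ.+ 5) ∷ (b ℕ.+ 5 , b ℕ.+ 0) ∷ []
  where b = 6 ℕ.* i

cutEdges : ℕ → List ℕ → List (ℕ × ℕ)
cutEdges i []       = []
cutEdges i (o ∷ os) = (6 ℕ.* i ℕ.+ o , 6 ℕ.* suc i) ∷ cutEdges (suc i) os

-- The polyphenylene chain with n hexagons H₁ … Hₙ (0-based in labels)
-- and distances (d₂,…,d_{n-1}).  Hexagon Hᵢ (i ≥ 2) is entered at its
-- position 0 and left at position dᵢ; H₁ is left at position 0.
chain : (n : ℕ) → Vec Dist (n ∸ 2) → Graph
chain zero ds = record { V = 0 ; E = [] }
chain (suc zero) ds = record { V = 6 ; E = hexEdges 0 }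
chain (suc (suc k)) ds = record
  { V = 6 ℕ.* suc (suc k)
  ; E = concatMap hexEdges (upTo (suc (suc k))) ++ cutEdges 0 (0 ∷ map distℕ (toList ds))
  }

-- Expectation over i.i.d. choices of (d₂,…,d_{k+1}):
-- ortho w.p. p₁, meta w.p. p₂, para w.p. 1 - p₁ - p₂.

expect : (p₁ p₂ : ℚ) (k : ℕ) → (Vec Dist k → ℚ) → ℚ
expect p₁ p₂ zero    f = f []
expect p₁ p₂ (suc k) f =
  p₁ * expect p₁ p₂ k (λ ds → f (ortho ∷ ds)) +
  p₂ * expect p₁ p₂ k (λ ds → f (meta ∷ ds)) +
  (1ℚ - p₁ - p₂) * expect p₁ p₂ k (λ ds → f (para ∷ ds))

den-pos : ∀ p₁ p₂ → 0ℚ ≤ p₁ → 0ℚ ≤ p₂ → Positive (11 + 4 * p₁ + p₂)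
den-pos p₁ p₂ h₁ h₂ = pos+nonNeg⇒pos (11 + 4 * p₁) {{pos+nonNeg⇒pos 11 (4 * p₁) {{nonNeg*nonNeg⇒nonNeg 4 p₁ {{nonNegative h₁}}}}}} p₂ {{nonNegative h₂}}

den-nz : ∀ p₁ p₂ → 0ℚ ≤ p₁ → 0ℚ ≤ p₂ → NonZero (11 + 4 * p₁ + p₂)
den-nz p₁ p₂ h₁ h₂ = pos⇒nonZero (11 + 4 * p₁ + p₂) {{den-pos p₁ p₂ h₁ h₂}}

den²-nz : ∀ p₁ p₂ → 0ℚ ≤ p₁ → 0ℚ ≤ p₂ →
          NonZero ((11 + 4 * p₁ + p₂) * (11 + 4 * p₁ + p₂))
den²-nz p₁ p₂ h₁ h₂ = pos⇒nonZero ((11 + 4 * p₁ + p₂) * (11 + 4 * p₁ + p₂)) {{pos*pos⇒pos (11 + 4 * p₁ + p₂) {{den-pos p₁ p₂ h₁ h₂}} (11 + 4 * p₁ + p₂) {{den-pos p₁ p₂ h₁ h₂}}}}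

-- The subtrees of a chain split along the cut edge leaving its first hexagon H: a subtree either
-- contains that edge, and is then a subtree of H through the exit vertex joined to a subtree of the
-- rest of the chain through its first vertex, or it lies in H or in the rest, the other part being
-- empty. A hexagon has 36 subtrees, 21 of them through a given vertex, and 21, 16, 13, 12, 13, 16
-- through both vertex 0 and vertex o = 0, …, 5. So the number N of subtrees and the number N₀ of
-- those through the first vertex satisfy N = 36 + N′ + 21 N₀′ and N₀ = 21 + t(o) N₀′, where primes
-- refer to the rest of the chain and t(o) ∈ {16, 13, 12} for ortho, meta, para. In expectation,
-- 𝔼N₀ ↦ 21 + (12 + 4p₁ + p₂) 𝔼N₀ and 𝔼N ↦ 36 + 𝔼N + 21 𝔼N₀ per added hexagon, and these linear
-- recurrences solve to the closed form.
-- Whether marked vertices and edges form a tree is decided by the same splitting: cutting a graph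
-- where exactly one edge, or none, crosses reduces the question to the two sides, down to single
-- hexagons, which are paths, cycles with one edge missing, or the full cycle.

module Submission where

module Trees where

  open import Level using (0ℓ)
  open import Data.Nat using (ℕ)
  open import Data.List using (List; []; _∷_; _++_)
  open import Data.List.Relation.Unary.Linked as Linked using (Linked; [-]; _∷_)
  open import Data.List.Relation.Unary.Unique.Propositional using (Unique)
  open import Data.List.Relation.Unary.Unique.Propositional.Properties using (Unique[x∷xs]⇒x∉xs)
  open import Data.List.Relation.Unary.AllPairs using (_∷_)
  open import Data.List.Membership.Propositional using (_∈_)
  open import Data.List.Membership.Propositional.Properties using (∈-++⁺ˡ)
  open import Data.List.Relation.Unary.Any using (here; there)
  open import Data.Product using (∃; _×_; _,_; proj₁; proj₂)
  open import Data.Sum using (_⊎_; inj₁; inj₂)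
  open import Data.Empty using (⊥-elim)
  open import Function.Bundles using (_⇔_; mk⇔; Equivalence)
  open import Relation.Nullary using (¬_; yes; no)
  open import Relation.Nullary.Decidable using (decidable-stable)
  open import Relation.Unary using (Pred; Decidable; Empty; _∩_; ∁; _⊆_)
  open import Relation.Binary.Core using (Rel; _⇒_)
  open import Relation.Binary.Definitions using (Symmetric)
  open import Relation.Binary.PropositionalEquality using (_≡_; refl; sym; trans; subst)
  open import Relation.Binary.Construct.Closure.ReflexiveTransitive as Star using (Star; ε; _◅_; _◅◅_)

  open Equivalence using (to; from)

  record IsTreeOn (P : Pred ℕ 0ℓ) (R : Rel ℕ 0ℓ) : Set where
    field
      nonempty  : ∃ P
      closed    : ∀ {u v} → R u v → P u × P v
      connected : ∀ {u v} → P u → P v → Star R u v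
      -- the only simple path joining the ends of an edge is that edge
      acyclic   : ∀ {u v} ys → R u v → Unique (u ∷ ys ++ v ∷ []) → Linked R (u ∷ ys ++ v ∷ []) → ys ≡ []

  open IsTreeOn public

  IsTreeOn-map : ∀ {P P′ R R′} → P ⊆ P′ → P′ ⊆ P → R ⇒ R′ → R′ ⇒ R → IsTreeOn P R → IsTreeOn P′ R′
  IsTreeOn-map P⊆P′ P′⊆P R⇒R′ R′⇒R T = record
    { nonempty  = let (x , px) = nonempty T in x , P⊆P′ px
    ; closed    = λ r → let (pu , pv) = closed T (R′⇒R r) in P⊆P′ pu , P⊆P′ pv
    ; connected = λ pu pv → Star.map R⇒R′ (connected T (P′⊆P pu) (P′⊆P pv))
    ; acyclic   = λ ys r u l → acyclic T ys (R′⇒R r) u (Linked.map R′⇒R l)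
    }

  IsTreeOn-cong : ∀ {P P′ R R′} → (∀ {x} → P x ⇔ P′ x) → (∀ {u v} → R u v ⇔ R′ u v) →
                  IsTreeOn P R ⇔ IsTreeOn P′ R′
  IsTreeOn-cong P⇔P′ R⇔R′ = mk⇔
    (IsTreeOn-map (to P⇔P′) (from P⇔P′) (to R⇔R′) (from R⇔R′))
    (IsTreeOn-map (from P⇔P′) (to P⇔P′) (from R⇔R′) (to R⇔R′))

  IsTreeOn-point : ∀ {P R} j {C : Set} → (∀ {x} → P x ⇔ (x ≡ j × C)) → (∀ {u v} → ¬ R u v) →
                   IsTreeOn P R ⇔ C
  IsTreeOn-point {P} {R} j P⇔ noEdge = mk⇔ (λ T → proj₂ (to P⇔ (proj₂ (nonempty T)))) point
    where
      point : _ → IsTreeOn P R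
      point c = record
        { nonempty  = j , from P⇔ (refl , c)
        ; closed    = λ r → ⊥-elim (noEdge r)
        ; connected = λ pu pv → subst (Star R _) (trans (proj₁ (to P⇔ pu)) (sym (proj₁ (to P⇔ pv)))) ε
        ; acyclic   = λ { [] _ _ _ → refl ; (_ ∷ _) r _ _ → ⊥-elim (noEdge r) }
        }

  _↾_ : Rel ℕ 0ℓ → Pred ℕ 0ℓ → Rel ℕ 0ℓ
  (R ↾ Q) u v = R u v × Q u × Q v

  Edgeless : Rel ℕ 0ℓ → Set
  Edgeless R = ∀ u v → ¬ R u v

  Empty-cong : ∀ {P Q : Pred ℕ 0ℓ} → (∀ {x} → P x ⇔ Q x) → Empty P ⇔ Empty Q
  Empty-cong P⇔Q = mk⇔ (λ e x q → e x (from P⇔Q q)) (λ e x p → e x (to P⇔Q p))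

  Edgeless-cong : ∀ {R S : Rel ℕ 0ℓ} → (∀ {u v} → R u v ⇔ S u v) → Edgeless R ⇔ Edgeless S
  Edgeless-cong R⇔S = mk⇔ (λ e u v s → e u v (from R⇔S s)) (λ e u v r → e u v (to R⇔S r))

  module _ {R : Rel ℕ 0ℓ} (R-sym : Symmetric R) where

    module Gate {Q : Pred ℕ 0ℓ} (Q? : Decidable Q) (q : ℕ)
                (leave : ∀ {u v} → R u v → Q u → ¬ Q v → u ≡ q) where

      enter : ∀ {u v} → R u v → ¬ Q u → Q v → v ≡ q
      enter r u∉Q v∈Q = leave (R-sym r) v∈Q u∉Q

      walk-inside : ∀ {x v} → Star R x v → Q v → (Q x → Star (R ↾ Q) x v) × (¬ Q x → Star (R ↾ Q) q v)
      walk-inside ε v∈Q = (λ _ → ε) , (λ x∉Q → ⊥-elim (x∉Q v∈Q))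
      walk-inside {x} (_◅_ {j = y} r rest) v∈Q with walk-inside rest v∈Q | Q? x | Q? y
      ... | from-y , _      | yes x∈Q | yes y∈Q = (λ _ → (r , x∈Q , y∈Q) ◅ from-y y∈Q) , (λ x∉Q → ⊥-elim (x∉Q x∈Q))
      ... | _      , from-q | yes x∈Q | no  y∉Q =
        (λ _ → subst (λ z → Star _ z _) (sym (leave r x∈Q y∉Q)) (from-q y∉Q)) , (λ x∉Q → ⊥-elim (x∉Q x∈Q))
      ... | from-y , _      | no  x∉Q | yes y∈Q =
        (λ x∈Q → ⊥-elim (x∉Q x∈Q)) , (λ _ → subst (λ z → Star _ z _) (enter r x∉Q y∈Q) (from-y y∈Q))
      ... | _      , from-q | no  x∉Q | no  y∉Q = (λ x∈Q → ⊥-elim (x∉Q x∈Q)) , (λ _ → from-q y∉Q)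

      gate-on-entry : ∀ {x w} zs → Linked R (x ∷ zs ++ w ∷ []) → ¬ Q x → Q w → q ∈ zs ++ w ∷ []
      gate-on-entry []       (r ∷ [-]) x∉Q w∈Q = here (sym (enter r x∉Q w∈Q))
      gate-on-entry (z ∷ zs) (r ∷ l)   x∉Q w∈Q with Q? z
      ... | yes z∈Q = here (sym (enter r x∉Q z∈Q))
      ... | no  z∉Q = there (gate-on-entry zs l z∉Q w∈Q)

      gate-on-exit : ∀ {x w} zs → Linked R (x ∷ zs ++ w ∷ []) → Q x → ¬ Q w → q ∈ x ∷ zs
      gate-on-exit []       (r ∷ [-]) x∈Q w∉Q = here (sym (leave r x∈Q w∉Q))
      gate-on-exit (z ∷ zs) (r ∷ l)   x∈Q w∉Q with Q? z
      ... | yes z∈Q = there (gate-on-exit zs l z∈Q w∉Q)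
      ... | no  z∉Q = here (sym (leave r x∈Q z∉Q))

      simple-path-inside : ∀ {x w} zs → Unique (x ∷ zs ++ w ∷ []) → Linked R (x ∷ zs ++ w ∷ []) →
                           Q x → Q w → Linked (R ↾ Q) (x ∷ zs ++ w ∷ [])
      simple-path-inside []       _            (r ∷ [-]) x∈Q w∈Q = (r , x∈Q , w∈Q) ∷ [-]
      simple-path-inside (z ∷ zs) (x∉ ∷ uniq) (r ∷ l)   x∈Q w∈Q with Q? z
      ... | yes z∈Q = (r , x∈Q , z∈Q) ∷ simple-path-inside zs uniq l z∈Q w∈Q
      ... | no  z∉Q = ⊥-elim (Unique[x∷xs]⇒x∉xs (x∉ ∷ uniq)
                        (there (subst (_∈ _) (sym (leave r x∈Q z∉Q)) (gate-on-entry zs l z∉Q w∈Q))))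

      restrict : ∀ {P} → IsTreeOn P R → ∃ (P ∩ Q) → IsTreeOn (P ∩ Q) (R ↾ Q)
      restrict T x = record
        { nonempty  = x
        ; closed    = λ { (r , u∈Q , v∈Q) → let (pu , pv) = closed T r in (pu , u∈Q) , (pv , v∈Q) }
        ; connected = λ { (pu , u∈Q) (pv , v∈Q) → proj₁ (walk-inside (connected T pu pv) v∈Q) u∈Q }
        ; acyclic   = λ ys r u l → acyclic T ys (proj₁ r) u (Linked.map proj₁ l)
        }

      module Outside (q′ : ℕ) (arrive : ∀ {u v} → R u v → Q u → ¬ Q v → v ≡ q′) where

        private
          last∈ : ∀ {v : ℕ} zs → v ∈ zs ++ v ∷ []
          last∈ []       = here refl
          last∈ (_ ∷ zs) = there (last∈ zs)

        crossing-acyclic : ∀ {u v} ys → R u v → Q u → ¬ Q v →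
                           Unique (u ∷ ys ++ v ∷ []) → Linked R (u ∷ ys ++ v ∷ []) → ys ≡ []
        crossing-acyclic []       _  _   _   _    _       = refl
        crossing-acyclic (y ∷ ys) uv u∈Q v∉Q uniq (r ∷ l) with Q? y
        ... | yes y∈Q = ⊥-elim (Unique[x∷xs]⇒x∉xs uniq
                          (∈-++⁺ˡ (subst (_∈ _) (sym (leave uv u∈Q v∉Q)) (gate-on-exit ys l y∈Q v∉Q))))
        ... | no  y∉Q = ⊥-elim (Unique[x∷xs]⇒x∉xs (tail uniq)
                          (subst (_∈ _) (trans (arrive uv u∈Q v∉Q) (sym (arrive r u∈Q y∉Q))) (last∈ ys)))
          where
            tail : ∀ {x : ℕ} {xs} → Unique (x ∷ xs) → Unique xs
            tail (_ ∷ t) = t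

    module Split (P : Pred ℕ 0ℓ) {A : Pred ℕ 0ℓ} (A? : Decidable A) where

      ∁A? : Decidable (∁ A)
      ∁A? x with A? x
      ... | yes a = no (λ ¬a → ¬a a)
      ... | no ¬a = yes ¬a

      private
        stable : ∀ {x} → ¬ ¬ A x → A x
        stable = decidable-stable (A? _)

      Sides : Set
      Sides = IsTreeOn (P ∩ A) (R ↾ A) × IsTreeOn (P ∩ ∁ A) (R ↾ ∁ A)

      module Bridge (a b : ℕ) (a∈A : A a) (b∉A : ¬ A b) (ab : R a b)
                    (cross : ∀ {u v} → R u v → A u → ¬ A v → u ≡ a × v ≡ b) where

        private
          leaveA : ∀ {u v} → R u v → A u → ¬ A v → u ≡ a
          leaveA r u∈A v∉A = proj₁ (cross r u∈A v∉A)
          arriveA : ∀ {u v} → R u v → A u → ¬ A v → v ≡ b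
          arriveA r u∈A v∉A = proj₂ (cross r u∈A v∉A)
          leaveB : ∀ {u v} → R u v → ¬ A u → ¬ ¬ A v → u ≡ b
          leaveB r u∉A v∈A = proj₂ (cross (R-sym r) (stable v∈A) u∉A)
          arriveB : ∀ {u v} → R u v → ¬ A u → ¬ ¬ A v → v ≡ a
          arriveB r u∉A v∈A = proj₁ (cross (R-sym r) (stable v∈A) u∉A)

          module GA = Gate A? a leaveA
          module GB = Gate ∁A? b leaveB
          module OA = GA.Outside b arriveA
          module OB = GB.Outside a arriveB

        cut : IsTreeOn P R → Sides × P a × P b
        cut T = (GA.restrict T (a , pa , a∈A) , GB.restrict T (b , pb , b∉A)) , pa , pb
          where
            pa = proj₁ (closed T ab)
            pb = proj₂ (closed T ab)

        glue : Sides × P a × P b → IsTreeOn P R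
        glue ((TA , TB) , pa , pb) = record
          { nonempty  = a , pa
          ; closed    = closed′
          ; connected = connected′
          ; acyclic   = acyclic′
          }
          where
            inA : ∀ {u v} → P u → A u → P v → A v → Star R u v
            inA pu au pv av = Star.map proj₁ (connected TA (pu , au) (pv , av))
            inB : ∀ {u v} → P u → ¬ A u → P v → ¬ A v → Star R u v
            inB pu au pv av = Star.map proj₁ (connected TB (pu , au) (pv , av))

            closed′ : ∀ {u v} → R u v → P u × P v
            closed′ {u} {v} r with A? u | A? v
            ... | yes u∈A | yes v∈A = let ((pu , _) , (pv , _)) = closed TA (r , u∈A , v∈A) in pu , pv
            ... | no  u∉A | no  v∉A = let ((pu , _) , (pv , _)) = closed TB (r , u∉A , v∉A) in pu , pv
            ... | yes u∈A | no  v∉A = let (u≡a , v≡b) = cross r u∈A v∉A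
                                      in subst P (sym u≡a) pa , subst P (sym v≡b) pb
            ... | no  u∉A | yes v∈A = let (v≡a , u≡b) = cross (R-sym r) v∈A u∉A
                                      in subst P (sym u≡b) pb , subst P (sym v≡a) pa

            connected′ : ∀ {u v} → P u → P v → Star R u v
            connected′ {u} {v} pu pv with A? u | A? v
            ... | yes u∈A | yes v∈A = inA pu u∈A pv v∈A
            ... | no  u∉A | no  v∉A = inB pu u∉A pv v∉A
            ... | yes u∈A | no  v∉A = inA pu u∈A pa a∈A ◅◅ ab ◅ inB pb b∉A pv v∉A
            ... | no  u∉A | yes v∈A = inB pu u∉A pb b∉A ◅◅ R-sym ab ◅ inA pa a∈A pv v∈A

            acyclic′ : ∀ {u v} ys → R u v → Unique (u ∷ ys ++ v ∷ []) → Linked R (u ∷ ys ++ v ∷ []) → ys ≡ []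
            acyclic′ {u} {v} ys r uniq l with A? u | A? v
            ... | yes u∈A | yes v∈A = acyclic TA ys (r , u∈A , v∈A) uniq (GA.simple-path-inside ys uniq l u∈A v∈A)
            ... | no  u∉A | no  v∉A = acyclic TB ys (r , u∉A , v∉A) uniq (GB.simple-path-inside ys uniq l u∉A v∉A)
            ... | yes u∈A | no  v∉A = OA.crossing-acyclic ys r u∈A v∉A uniq l
            ... | no  u∉A | yes v∈A = OB.crossing-acyclic ys r u∉A (λ v∉A → v∉A v∈A) uniq l

        split : IsTreeOn P R ⇔ (Sides × P a × P b)
        split = mk⇔ cut glue

      module NoBridge (A-closed : ∀ {u v} → R u v → A u → A v) where

        OneSide : Set
        OneSide = (IsTreeOn (P ∩ A) (R ↾ A) × Empty (P ∩ ∁ A) × Edgeless (R ↾ ∁ A))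
                ⊎ (IsTreeOn (P ∩ ∁ A) (R ↾ ∁ A) × Empty (P ∩ A) × Edgeless (R ↾ A))

        private
          ∁A-closed : ∀ {u v} → R u v → ¬ A u → ¬ A v
          ∁A-closed r u∉A v∈A = u∉A (A-closed (R-sym r) v∈A)

          module GA = Gate A? 0 (λ r u∈A v∉A → ⊥-elim (v∉A (A-closed r u∈A)))
          module GB = Gate ∁A? 0 (λ r u∉A v∈A → ⊥-elim (v∈A (∁A-closed r u∉A)))

          stays : ∀ {Q : Pred ℕ 0ℓ} → (∀ {u v} → R u v → Q u → Q v) → ∀ {x y} → Star R x y → Q x → Q y
          stays Q-closed ε        x∈Q = x∈Q
          stays Q-closed (r ◅ rs) x∈Q = stays Q-closed rs (Q-closed r x∈Q)

        cut : IsTreeOn P R → OneSide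
        cut T with nonempty T
        ... | x , px with A? x
        ...   | yes x∈A = inj₁ (GA.restrict T (x , px , x∈A) , (λ y (py , y∉A) → y∉A (inA py)) ,
                                (λ u v (r , u∉A , _) → u∉A (inA (proj₁ (closed T r)))))
          where
            inA : ∀ {y} → P y → A y
            inA py = stays A-closed (connected T px py) x∈A
        ...   | no  x∉A = inj₂ (GB.restrict T (x , px , x∉A) , (λ y (py , y∈A) → inB py y∈A) ,
                                (λ u v (r , u∈A , _) → inB (proj₁ (closed T r)) u∈A))
          where
            inB : ∀ {y} → P y → ¬ A y
            inB py = stays ∁A-closed (connected T px py) x∉A

        glue : OneSide → IsTreeOn P R
        glue (inj₁ (TA , noB , noRB)) = IsTreeOn-map proj₁ toA proj₁ toRA TA
          where
            toA : ∀ {x} → P x → (P ∩ A) x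
            toA {x} px with A? x
            ... | yes x∈A = px , x∈A
            ... | no  x∉A = ⊥-elim (noB x (px , x∉A))
            toRA : ∀ {u v} → R u v → (R ↾ A) u v
            toRA {u} {v} r with A? u
            ... | yes u∈A = r , u∈A , A-closed r u∈A
            ... | no  u∉A = ⊥-elim (noRB u v (r , u∉A , ∁A-closed r u∉A))
        glue (inj₂ (TB , noA , noRA)) = IsTreeOn-map proj₁ toB proj₁ toRB TB
          where
            toB : ∀ {x} → P x → (P ∩ ∁ A) x
            toB {x} px with A? x
            ... | yes x∈A = ⊥-elim (noA x (px , x∈A))
            ... | no  x∉A = px , x∉A
            toRB : ∀ {u v} → R u v → (R ↾ ∁ A) u v
            toRB {u} {v} r with A? u
            ... | yes u∈A = ⊥-elim (noRA u v (r , u∈A , A-closed r u∈A))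
            ... | no  u∉A = r , u∉A , ∁A-closed r u∉A

        split : IsTreeOn P R ⇔ OneSide
        split = mk⇔ cut glue

open Trees

module Hexagons where

  open import Level using (0ℓ)
  open import Data.Nat using (ℕ; zero; suc; _+_; _≤_; _<_; _≤?_; s≤s)
  open import Data.Nat.Properties
    using (≤-refl; ≤-trans; n≤1+n; <⇒≱; 1+n≰n; +-suc; m≤n+m; ≤-pred; +-cancelˡ-≡; m≢1+n+m)
  open import Data.Bool using (Bool; true; false; not; _∧_)
  open import Data.Bool.Properties using (_≟_)
  open import Data.Vec using (Vec; []; _∷_; _++_)
  open import Data.List using ([]; _∷_)
  open import Data.List.Relation.Unary.Linked using ([-]; _∷_)
  open import Data.List.Relation.Unary.AllPairs using ([]; _∷_)
  open import Data.List.Relation.Unary.All using ([]; _∷_)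
  open import Data.Product using (_×_; _,_; proj₁; proj₂)
  open import Data.Product.Function.NonDependent.Propositional using (_×-⇔_)
  open import Data.Sum using (_⊎_; inj₁; inj₂; [_,_]′)
  open import Data.Sum.Function.Propositional using (_⊎-⇔_)
  open import Data.Empty using (⊥; ⊥-elim)
  open import Function.Base using (case_of_)
  open import Function.Bundles using (_⇔_; mk⇔; Equivalence)
  open import Function.Construct.Identity using (⇔-id)
  open import Function.Construct.Composition using (_⇔-∘_)
  open import Function.Construct.Symmetry using (⇔-sym)
  open import Relation.Nullary using (¬_; Dec; yes; no)
  open import Relation.Nullary.Decidable using (map; _×-dec_; _⊎-dec_; ¬?)
  open import Relation.Unary using (Pred; Empty; _∪_)
  open import Relation.Binary.Core using (Rel)
  open import Relation.Binary.Definitions using (Symmetric)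
  open import Relation.Binary.PropositionalEquality using (_≡_; _≢_; refl; sym; subst; cong)

  open Equivalence using (to; from)

  private
    variable
      n : ℕ

  Joins : ℕ → ℕ → Rel ℕ 0ℓ
  Joins a b u v = (u ≡ a × v ≡ b) ⊎ (u ≡ b × v ≡ a)

  Joins-sym : ∀ {a b} → Symmetric (Joins a b)
  Joins-sym (inj₁ (u≡a , v≡b)) = inj₂ (v≡b , u≡a)
  Joins-sym (inj₂ (u≡b , v≡a)) = inj₁ (v≡a , u≡b)

  Joins-comm : ∀ {a b u v} → Joins a b u v ⇔ Joins b a u v
  Joins-comm = mk⇔ swap swap
    where
      swap : ∀ {a b u v} → Joins a b u v → Joins b a u v
      swap (inj₁ p) = inj₂ p
      swap (inj₂ p) = inj₁ p

  Marked : ℕ → Vec Bool n → Pred ℕ 0ℓ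
  Marked j []       x = ⊥
  Marked j (c ∷ cs) x = (x ≡ j × c ≡ true) ⊎ Marked (suc j) cs x

  PathEdges : ℕ → Vec Bool n → Rel ℕ 0ℓ
  PathEdges j []       u v = ⊥
  PathEdges j (b ∷ bs) u v = (b ≡ true × Joins j (suc j) u v) ⊎ PathEdges (suc j) bs u v

  PathEdges-sym : ∀ j (bs : Vec Bool n) → Symmetric (PathEdges j bs)
  PathEdges-sym j (b ∷ bs) (inj₁ (b≡true , uv)) = inj₁ (b≡true , Joins-sym uv)
  PathEdges-sym j (b ∷ bs) (inj₂ e)             = inj₂ (PathEdges-sym (suc j) bs e)

  Marked-lower : ∀ j (cs : Vec Bool n) {x} → Marked j cs x → j ≤ x
  Marked-lower j (c ∷ cs) (inj₁ (refl , _)) = ≤-refl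
  Marked-lower j (c ∷ cs) (inj₂ p)          = ≤-trans (n≤1+n j) (Marked-lower (suc j) cs p)

  Marked-upper : ∀ j {n} (cs : Vec Bool n) {x} → Marked j cs x → x < n + j
  Marked-upper j {suc n} (c ∷ cs) (inj₁ (refl , _)) = s≤s (m≤n+m j n)
  Marked-upper j {suc n} (c ∷ cs) {x} (inj₂ p) = subst (x <_) (+-suc n j) (Marked-upper (suc j) cs p)

  PathEdges-lower : ∀ j (bs : Vec Bool n) {u v} → PathEdges j bs u v → j ≤ u × j ≤ v
  PathEdges-lower j (b ∷ bs) (inj₁ (_ , inj₁ (refl , refl))) = ≤-refl , n≤1+n j
  PathEdges-lower j (b ∷ bs) (inj₁ (_ , inj₂ (refl , refl))) = n≤1+n j , ≤-refl
  PathEdges-lower j (b ∷ bs) (inj₂ e) =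
    let (u≥ , v≥) = PathEdges-lower (suc j) bs e in ≤-trans (n≤1+n j) u≥ , ≤-trans (n≤1+n j) v≥

  PathEdges-upper : ∀ j {n} (bs : Vec Bool n) {u v} → PathEdges j bs u v → u ≤ n + j × v ≤ n + j
  PathEdges-upper j {suc n} (b ∷ bs) (inj₁ (_ , inj₁ (refl , refl))) = ≤-trans (n≤1+n j) (s≤s (m≤n+m j n)) , s≤s (m≤n+m j n)
  PathEdges-upper j {suc n} (b ∷ bs) (inj₁ (_ , inj₂ (refl , refl))) = s≤s (m≤n+m j n) , ≤-trans (n≤1+n j) (s≤s (m≤n+m j n))
  PathEdges-upper j {suc n} (b ∷ bs) {u} {v} (inj₂ e) =
    let (u≤ , v≤) = PathEdges-upper (suc j) bs e in subst (u ≤_) (+-suc n j) u≤ , subst (v ≤_) (+-suc n j) v≤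

  bitAt : Vec Bool n → ℕ → Bool
  bitAt []       k       = false
  bitAt (b ∷ bs) zero    = b
  bitAt (b ∷ bs) (suc k) = bitAt bs k

  Marked-at : ∀ j (cs : Vec Bool n) k → Marked j cs (k + j) ⇔ (bitAt cs k ≡ true)
  Marked-at j []       k       = mk⇔ (λ ()) (λ ())
  Marked-at j (c ∷ cs) zero    = mk⇔ [ proj₂ , (λ p → ⊥-elim (1+n≰n (Marked-lower (suc j) cs p))) ]′
                                     (λ c≡true → inj₁ (refl , c≡true))
  Marked-at j (c ∷ cs) (suc k) = mk⇔
    [ (λ (e , _) → ⊥-elim (1+n≰n (subst (suc j ≤_) e (s≤s (m≤n+m j k)))))
    , (λ p → to (Marked-at (suc j) cs k) (subst (Marked (suc j) cs) (sym (+-suc k j)) p)) ]′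
    (λ bit → inj₂ (subst (Marked (suc j) cs) (+-suc k j) (from (Marked-at (suc j) cs k) bit)))

  allFalse : Vec Bool n → Bool
  allFalse []       = true
  allFalse (b ∷ bs) = not b ∧ allFalse bs

  Marked-empty : ∀ j (cs : Vec Bool n) → Empty (Marked j cs) ⇔ (allFalse cs ≡ true)
  Marked-empty j []           = mk⇔ (λ _ → refl) (λ _ _ ())
  Marked-empty j (true ∷ cs)  = mk⇔ (λ e → ⊥-elim (e j (inj₁ (refl , refl)))) (λ ())
  Marked-empty j (false ∷ cs) = mk⇔
    (λ e → to (Marked-empty (suc j) cs) (λ x p → e x (inj₂ p)))
    (λ none → λ { x (inj₁ (_ , ())) ; x (inj₂ p) → from (Marked-empty (suc j) cs) none x p })

  PathEdges-empty : ∀ j (bs : Vec Bool n) → Edgeless (PathEdges j bs) ⇔ (allFalse bs ≡ true)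
  PathEdges-empty j []           = mk⇔ (λ _ → refl) (λ _ _ _ ())
  PathEdges-empty j (true ∷ bs)  = mk⇔ (λ e → ⊥-elim (e j (suc j) (inj₁ (refl , inj₁ (refl , refl))))) (λ ())
  PathEdges-empty j (false ∷ bs) = mk⇔
    (λ e → to (PathEdges-empty (suc j) bs) (λ u v p → e u v (inj₂ p)))
    (λ none → λ { u v (inj₁ (() , _)) ; u v (inj₂ p) → from (PathEdges-empty (suc j) bs) none u v p })

  module Glue {P₁ P₂ : Pred ℕ 0ℓ} {R₁ R₂ : Rel ℕ 0ℓ} (R₁-sym : Symmetric R₁) (R₂-sym : Symmetric R₂)
              (k : ℕ) (P₁≤ : ∀ {x} → P₁ x → x ≤ k) (P₂> : ∀ {x} → P₂ x → k < x)
              (R₁≤ : ∀ {u v} → R₁ u v → u ≤ k × v ≤ k) (R₂> : ∀ {u v} → R₂ u v → k < u × k < v)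
              {a b : ℕ} (a≤k : a ≤ k) (k<b : k < b) where

    Glued : Bool → Rel ℕ 0ℓ
    Glued c u v = R₁ u v ⊎ (c ≡ true × Joins a b u v) ⊎ R₂ u v

    private
      P : Pred ℕ 0ℓ
      P = P₁ ∪ P₂

      Glued-sym : ∀ c → Symmetric (Glued c)
      Glued-sym c (inj₁ r)               = inj₁ (R₁-sym r)
      Glued-sym c (inj₂ (inj₁ (t , uv))) = inj₂ (inj₁ (t , Joins-sym uv))
      Glued-sym c (inj₂ (inj₂ r))        = inj₂ (inj₂ (R₂-sym r))

      below : ∀ {x} → x ≤ k → k < x → ⊥
      below x≤k k<x = <⇒≱ k<x x≤k

      low : ∀ x → Dec (x ≤ k)
      low x = x Data.Nat.≤? k

      P-low : ∀ {x} → (P x × x ≤ k) ⇔ P₁ x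
      P-low = mk⇔ (λ { (inj₁ p , _) → p ; (inj₂ p , x≤k) → ⊥-elim (below x≤k (P₂> p)) }) (λ p → inj₁ p , P₁≤ p)

      P-high : ∀ {x} → (P x × ¬ x ≤ k) ⇔ P₂ x
      P-high = mk⇔ (λ { (inj₁ p , x≰k) → ⊥-elim (x≰k (P₁≤ p)) ; (inj₂ p , _) → p }) (λ p → inj₂ p , <⇒≱ (P₂> p))

      Glued-low : ∀ {c u v} → (Glued c u v × u ≤ k × v ≤ k) ⇔ R₁ u v
      Glued-low = mk⇔
        (λ { (inj₁ r , _) → r
           ; (inj₂ (inj₁ (_ , inj₁ (_ , refl))) , _ , v≤k) → ⊥-elim (below v≤k k<b)
           ; (inj₂ (inj₁ (_ , inj₂ (refl , _))) , u≤k , _) → ⊥-elim (below u≤k k<b)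
           ; (inj₂ (inj₂ r) , u≤k , _) → ⊥-elim (below u≤k (proj₁ (R₂> r))) })
        (λ r → inj₁ r , R₁≤ r)

      Glued-high : ∀ {c u v} → (Glued c u v × ¬ u ≤ k × ¬ v ≤ k) ⇔ R₂ u v
      Glued-high = mk⇔
        (λ { (inj₁ r , u≰k , _) → ⊥-elim (u≰k (proj₁ (R₁≤ r)))
           ; (inj₂ (inj₁ (_ , inj₁ (refl , _))) , u≰k , _) → ⊥-elim (u≰k a≤k)
           ; (inj₂ (inj₁ (_ , inj₂ (_ , refl))) , _ , v≰k) → ⊥-elim (v≰k a≤k)
           ; (inj₂ (inj₂ r) , _) → r })
        (λ r → inj₂ (inj₂ r) , <⇒≱ (proj₁ (R₂> r)) , <⇒≱ (proj₂ (R₂> r)))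

      sides : ∀ {c} → Split.Sides (Glued-sym c) P low ⇔ (IsTreeOn P₁ R₁ × IsTreeOn P₂ R₂)
      sides = IsTreeOn-cong P-low Glued-low ×-⇔ IsTreeOn-cong P-high Glued-high

      cross : ∀ {u v} → Glued true u v → u ≤ k → ¬ v ≤ k → u ≡ a × v ≡ b
      cross (inj₁ r)                            _   v≰k = ⊥-elim (v≰k (proj₂ (R₁≤ r)))
      cross (inj₂ (inj₁ (_ , inj₁ ab)))         _   _   = ab
      cross (inj₂ (inj₁ (_ , inj₂ (refl , _)))) u≤k _   = ⊥-elim (below u≤k k<b)
      cross (inj₂ (inj₂ r))                     u≤k _   = ⊥-elim (below u≤k (proj₁ (R₂> r)))

      low-closed : ∀ {u v} → Glued false u v → u ≤ k → v ≤ k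
      low-closed (inj₁ r) _            = proj₂ (R₁≤ r)
      low-closed (inj₂ (inj₁ (() , _)))
      low-closed (inj₂ (inj₂ r)) u≤k   = ⊥-elim (below u≤k (proj₁ (R₂> r)))

      module B = Split.Bridge (Glued-sym true) P low a b a≤k (<⇒≱ k<b) (inj₂ (inj₁ (refl , inj₁ (refl , refl)))) cross
      module N = Split.NoBridge (Glued-sym false) P low low-closed

      P-a : P a ⇔ P₁ a
      P-a = mk⇔ [ (λ p → p) , (λ p → ⊥-elim (below a≤k (P₂> p))) ]′ inj₁

      P-b : P b ⇔ P₂ b
      P-b = mk⇔ [ (λ p → ⊥-elim (below (P₁≤ p) k<b)) , (λ p → p) ]′ inj₂

    joined : IsTreeOn P (Glued true) ⇔ ((IsTreeOn P₁ R₁ × IsTreeOn P₂ R₂) × P₁ a × P₂ b)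
    joined = (sides ×-⇔ P-a ×-⇔ P-b) ⇔-∘ B.split

    separate : IsTreeOn P (Glued false) ⇔
               ((IsTreeOn P₁ R₁ × Empty P₂ × Edgeless R₂) ⊎ (IsTreeOn P₂ R₂ × Empty P₁ × Edgeless R₁))
    separate = ((IsTreeOn-cong P-low Glued-low ×-⇔ Empty-cong P-high ×-⇔ Edgeless-cong Glued-high)
               ⊎-⇔ (IsTreeOn-cong P-high Glued-high ×-⇔ Empty-cong P-low ×-⇔ Edgeless-cong Glued-low))
               ⇔-∘ N.split

    joined? : Dec (IsTreeOn P₁ R₁) → Dec (IsTreeOn P₂ R₂) → Dec (P₁ a) → Dec (P₂ b) → Dec (IsTreeOn P (Glued true))
    joined? t₁ t₂ pa pb = map (⇔-sym joined) ((t₁ ×-dec t₂) ×-dec pa ×-dec pb)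

    separate? : Dec (IsTreeOn P₁ R₁) → Dec (IsTreeOn P₂ R₂) → Dec (Empty P₁ × Edgeless R₁) → Dec (Empty P₂ × Edgeless R₂) →
                Dec (IsTreeOn P (Glued false))
    separate? t₁ t₂ e₁ e₂ = map (⇔-sym separate) ((t₁ ×-dec e₂) ⊎-dec (t₂ ×-dec e₁))

  Marked-empty? : ∀ j (cs : Vec Bool n) → Dec (Empty (Marked j cs))
  Marked-empty? j cs = map (⇔-sym (Marked-empty j cs)) (allFalse cs ≟ true)

  PathEdges-empty? : ∀ j (bs : Vec Bool n) → Dec (Edgeless (PathEdges j bs))
  PathEdges-empty? j bs = map (⇔-sym (PathEdges-empty j bs)) (allFalse bs ≟ true)

  Marked-at? : ∀ j (cs : Vec Bool n) k → Dec (Marked j cs (k + j))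
  Marked-at? j cs k = map (⇔-sym (Marked-at j cs k)) (bitAt cs k ≟ true)

  path? : ∀ j {n} (cs : Vec Bool (suc n)) (bs : Vec Bool n) → Dec (IsTreeOn (Marked j cs) (PathEdges j bs))
  path? j (c ∷ []) [] = map (⇔-sym (IsTreeOn-point j only (λ ()))) (c ≟ true)
    where
      only : ∀ {x} → Marked j (c ∷ []) x ⇔ (x ≡ j × c ≡ true)
      only = mk⇔ [ (λ p → p) , (λ ()) ]′ inj₁
  path? j (c ∷ c′ ∷ cs) (b ∷ bs) = map (IsTreeOn-cong (⇔-id _) path-edges) (glued b)
    where
      First : Pred ℕ 0ℓ
      First x = x ≡ j × c ≡ true
      NoEdge : Rel ℕ 0ℓ
      NoEdge _ _ = ⊥
      First≤ : ∀ {x} → First x → x ≤ j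
      First≤ (refl , _) = ≤-refl
      NoEdge≤ : ∀ {u v} → NoEdge u v → u ≤ j × v ≤ j
      NoEdge≤ ()
      module G = Glue {First} {Marked (suc j) (c′ ∷ cs)} (λ ()) (PathEdges-sym (suc j) bs) j
                   First≤ (Marked-lower (suc j) (c′ ∷ cs)) NoEdge≤ (PathEdges-lower (suc j) bs) ≤-refl ≤-refl

      path-edges : ∀ {u v} → G.Glued b u v ⇔ PathEdges j (b ∷ bs) u v
      path-edges = mk⇔ [ (λ ()) , (λ e → e) ]′ inj₂

      first? : Dec (IsTreeOn First NoEdge)
      first? = map (⇔-sym (IsTreeOn-point j (⇔-id _) (λ ()))) (c ≟ true)

      no-first : Empty First ⇔ (¬ c ≡ true)
      no-first = mk⇔ (λ e c≡true → e j (refl , c≡true)) (λ c≢true _ (_ , c≡true) → c≢true c≡true)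

      glued : ∀ b → Dec (IsTreeOn (Marked j (c ∷ c′ ∷ cs)) (G.Glued b))
      glued true  = G.joined? first? (path? (suc j) (c′ ∷ cs) bs) (yes refl ×-dec c ≟ true)
                      (Marked-at? (suc j) (c′ ∷ cs) 0)
      glued false = G.separate? first? (path? (suc j) (c′ ∷ cs) bs)
                      (map (⇔-sym no-first) (¬? (c ≟ true)) ×-dec yes (λ _ _ ()))
                      (Marked-empty? (suc j) (c′ ∷ cs) ×-dec PathEdges-empty? (suc j) bs)

  Marked-++ : ∀ j {k m} (cs₁ : Vec Bool k) (cs₂ : Vec Bool m) {x} →
              Marked j (cs₁ ++ cs₂) x ⇔ (Marked j cs₁ x ⊎ Marked (k + j) cs₂ x)
  Marked-++ j []         cs₂ = mk⇔ inj₂ [ (λ ()) , (λ p → p) ]′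
  Marked-++ j {suc k} (c ∷ cs₁) cs₂ {x} = mk⇔
    [ (λ p → inj₁ (inj₁ p)) , (λ p → [ (λ q → inj₁ (inj₂ q)) , (λ q → inj₂ (shift q)) ]′ (to (Marked-++ (suc j) cs₁ cs₂) p)) ]′
    [ [ inj₁ , (λ p → inj₂ (from (Marked-++ (suc j) cs₁ cs₂) (inj₁ p))) ]′
    , (λ p → inj₂ (from (Marked-++ (suc j) cs₁ cs₂) (inj₂ (subst (λ i → Marked i cs₂ x) (sym (+-suc k j)) p)))) ]′
    where
      shift : Marked (k + suc j) cs₂ x → Marked (suc k + j) cs₂ x
      shift = subst (λ i → Marked i cs₂ x) (+-suc k j)

  PathEdges-++ : ∀ j {k m} (bs₁ : Vec Bool k) (bs₂ : Vec Bool m) {u v} →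
                 PathEdges j (bs₁ ++ false ∷ bs₂) u v ⇔ (PathEdges j bs₁ u v ⊎ PathEdges (suc k + j) bs₂ u v)
  PathEdges-++ j [] bs₂ = mk⇔ [ (λ { (() , _) }) , inj₂ ]′ [ (λ ()) , inj₂ ]′
  PathEdges-++ j {suc k} (b ∷ bs₁) bs₂ {u} {v} = mk⇔
    [ (λ e → inj₁ (inj₁ e)) , (λ e → [ (λ f → inj₁ (inj₂ f)) , (λ f → inj₂ (shift f)) ]′ (to (PathEdges-++ (suc j) bs₁ bs₂) e)) ]′
    [ [ inj₁ , (λ e → inj₂ (from (PathEdges-++ (suc j) bs₁ bs₂) (inj₁ e))) ]′
    , (λ e → inj₂ (from (PathEdges-++ (suc j) bs₁ bs₂) (inj₂ (subst (λ i → PathEdges i bs₂ u v) (sym (cong suc (+-suc k j))) e)))) ]′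
    where
      shift : PathEdges (suc (k + suc j)) bs₂ u v → PathEdges (suc (suc k + j)) bs₂ u v
      shift = subst (λ i → PathEdges i bs₂ u v) (cong suc (+-suc k j))

  -- A cycle with one edge missing, seen as two paths joined by the closing edge.
  module _ (j : ℕ) {k m : ℕ} (cs₁ : Vec Bool (suc k)) (cs₂ : Vec Bool (suc m)) (bs₁ : Vec Bool k) (bs₂ : Vec Bool m) where

    private
      z : ℕ
      z = m + (suc k + j)

      first≤ : ∀ {x} → Marked j cs₁ x → x ≤ k + j
      first≤ p = ≤-pred (Marked-upper j cs₁ p)

      module G = Glue (PathEdges-sym j bs₁) (PathEdges-sym (suc k + j) bs₂) (k + j)
                   first≤ (Marked-lower (suc k + j) cs₂) (PathEdges-upper j bs₁) (PathEdges-lower (suc k + j) bs₂)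
                   (m≤n+m j k) (m≤n+m (suc k + j) m)

      cycle-edges : ∀ {u v} → G.Glued true u v ⇔ (PathEdges j (bs₁ ++ false ∷ bs₂) u v ⊎ (true ≡ true × Joins z j u v))
      cycle-edges = mk⇔
        [ (λ e → inj₁ (from (PathEdges-++ j bs₁ bs₂) (inj₁ e)))
        , [ (λ (t , uv) → inj₂ (t , to Joins-comm uv)) , (λ e → inj₁ (from (PathEdges-++ j bs₁ bs₂) (inj₂ e))) ]′ ]′
        [ (λ e → [ inj₁ , (λ f → inj₂ (inj₂ f)) ]′ (to (PathEdges-++ j bs₁ bs₂) e))
        , (λ (t , uv) → inj₂ (inj₁ (t , to Joins-comm uv))) ]′

    broken-cycle? : Dec (IsTreeOn (Marked j (cs₁ ++ cs₂))
                                   (λ u v → PathEdges j (bs₁ ++ false ∷ bs₂) u v ⊎ (true ≡ true × Joins z j u v)))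
    broken-cycle? = map (IsTreeOn-cong (⇔-sym (Marked-++ j cs₁ cs₂)) cycle-edges)
                        (G.joined? (path? j cs₁ bs₁) (path? (suc k + j) cs₂ bs₂)
                                   (Marked-at? j cs₁ 0) (Marked-at? (suc k + j) cs₂ m))

  HexEdges : ℕ → Vec Bool 6 → Rel ℕ 0ℓ
  HexEdges j (b₀ ∷ b₁ ∷ b₂ ∷ b₃ ∷ b₄ ∷ b₅ ∷ []) u v =
    PathEdges j (b₀ ∷ b₁ ∷ b₂ ∷ b₃ ∷ b₄ ∷ []) u v ⊎ (b₅ ≡ true × Joins (5 + j) j u v)

  HexEdges-sym : ∀ j f → Symmetric (HexEdges j f)
  HexEdges-sym j (_ ∷ _ ∷ _ ∷ _ ∷ _ ∷ _ ∷ []) (inj₁ e)        = inj₁ (PathEdges-sym j _ e)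
  HexEdges-sym j (_ ∷ _ ∷ _ ∷ _ ∷ _ ∷ _ ∷ []) (inj₂ (t , uv)) = inj₂ (t , Joins-sym uv)

  HexEdges-lower : ∀ j f {u v} → HexEdges j f u v → j ≤ u × j ≤ v
  HexEdges-lower j (_ ∷ _ ∷ _ ∷ _ ∷ _ ∷ _ ∷ []) (inj₁ e)                       = PathEdges-lower j _ e
  HexEdges-lower j (_ ∷ _ ∷ _ ∷ _ ∷ _ ∷ _ ∷ []) (inj₂ (_ , inj₁ (refl , refl))) = m≤n+m j 5 , ≤-refl
  HexEdges-lower j (_ ∷ _ ∷ _ ∷ _ ∷ _ ∷ _ ∷ []) (inj₂ (_ , inj₂ (refl , refl))) = ≤-refl , m≤n+m j 5

  HexEdges-upper : ∀ j f {u v} → HexEdges j f u v → u ≤ 5 + j × v ≤ 5 + j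
  HexEdges-upper j (_ ∷ _ ∷ _ ∷ _ ∷ _ ∷ _ ∷ []) (inj₁ e)                       = PathEdges-upper j _ e
  HexEdges-upper j (_ ∷ _ ∷ _ ∷ _ ∷ _ ∷ _ ∷ []) (inj₂ (_ , inj₁ (refl , refl))) = ≤-refl , m≤n+m j 5
  HexEdges-upper j (_ ∷ _ ∷ _ ∷ _ ∷ _ ∷ _ ∷ []) (inj₂ (_ , inj₂ (refl , refl))) = m≤n+m j 5 , ≤-refl

  HexEdges-empty : ∀ j f → Edgeless (HexEdges j f) ⇔ (allFalse f ≡ true)
  HexEdges-empty j (b₀ ∷ b₁ ∷ b₂ ∷ b₃ ∷ b₄ ∷ true ∷ []) =
    mk⇔ (λ e → ⊥-elim (e (5 + j) j (inj₂ (refl , inj₁ (refl , refl))))) (λ none → ⊥-elim (lastTrue b₀ b₁ b₂ b₃ b₄ none))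
    where
      lastTrue : ∀ b₀ b₁ b₂ b₃ b₄ → allFalse (b₀ ∷ b₁ ∷ b₂ ∷ b₃ ∷ b₄ ∷ true ∷ []) ≢ true
      lastTrue true  _     _     _     _     ()
      lastTrue false true  _     _     _     ()
      lastTrue false false true  _     _     ()
      lastTrue false false false true  _     ()
      lastTrue false false false false true  ()
      lastTrue false false false false false ()
  HexEdges-empty j (b₀ ∷ b₁ ∷ b₂ ∷ b₃ ∷ b₄ ∷ false ∷ []) =
    mk⇔ (λ e → subst (_≡ true) (allFalse-snoc b₀ b₁ b₂ b₃ b₄) (to (PathEdges-empty j _) (λ u v p → e u v (inj₁ p))))
        (λ none → λ { u v (inj₁ p) → from (PathEdges-empty j _) (subst (_≡ true) (sym (allFalse-snoc b₀ b₁ b₂ b₃ b₄)) none) u v p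
                    ; u v (inj₂ (() , _)) })
    where
      allFalse-snoc : ∀ b₀ b₁ b₂ b₃ b₄ → allFalse (b₀ ∷ b₁ ∷ b₂ ∷ b₃ ∷ b₄ ∷ []) ≡ allFalse (b₀ ∷ b₁ ∷ b₂ ∷ b₃ ∷ b₄ ∷ false ∷ [])
      allFalse-snoc true  _     _     _     _     = refl
      allFalse-snoc false true  _     _     _     = refl
      allFalse-snoc false false true  _     _     = refl
      allFalse-snoc false false false true  _     = refl
      allFalse-snoc false false false false true  = refl
      allFalse-snoc false false false false false = refl

  hexagon-cycle : ∀ j {P} → ¬ IsTreeOn P (HexEdges j (true ∷ true ∷ true ∷ true ∷ true ∷ true ∷ []))
  hexagon-cycle j T = case acyclic T (1 + j ∷ 2 + j ∷ 3 + j ∷ 4 + j ∷ []) (inj₂ (refl , inj₂ (refl , refl))) distinct around of λ ()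
    where
      step : ∀ i → true ≡ true × Joins (i + j) (suc (i + j)) (i + j) (suc (i + j))
      step i = refl , inj₁ (refl , refl)
      around = inj₁ (inj₁ (step 0)) ∷ inj₁ (inj₂ (inj₁ (step 1))) ∷ inj₁ (inj₂ (inj₂ (inj₁ (step 2)))) ∷
               inj₁ (inj₂ (inj₂ (inj₂ (inj₁ (step 3))))) ∷ inj₁ (inj₂ (inj₂ (inj₂ (inj₂ (inj₁ (step 4)))))) ∷ [-]
      apart : ∀ a d → a + j ≢ a + (suc d + j)
      apart a d e = m≢1+n+m j (+-cancelˡ-≡ a _ _ e)
      distinct = (apart 0 0 ∷ apart 0 1 ∷ apart 0 2 ∷ apart 0 3 ∷ apart 0 4 ∷ []) ∷
                 (apart 1 0 ∷ apart 1 1 ∷ apart 1 2 ∷ apart 1 3 ∷ []) ∷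
                 (apart 2 0 ∷ apart 2 1 ∷ apart 2 2 ∷ []) ∷
                 (apart 3 0 ∷ apart 3 1 ∷ []) ∷
                 (apart 4 0 ∷ []) ∷ [] ∷ []

  hexagon? : ∀ j (s f : Vec Bool 6) → Dec (IsTreeOn (Marked j s) (HexEdges j f))
  hexagon? j s (b₀ ∷ b₁ ∷ b₂ ∷ b₃ ∷ b₄ ∷ false ∷ []) =
    map (IsTreeOn-cong (⇔-id _) (mk⇔ inj₁ [ (λ e → e) , (λ { (() , _) }) ]′)) (path? j s (b₀ ∷ b₁ ∷ b₂ ∷ b₃ ∷ b₄ ∷ []))
  hexagon? j (s₀ ∷ s₁ ∷ s₂ ∷ s₃ ∷ s₄ ∷ s₅ ∷ []) (false ∷ b₁ ∷ b₂ ∷ b₃ ∷ b₄ ∷ true ∷ []) =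
    broken-cycle? j (s₀ ∷ []) (s₁ ∷ s₂ ∷ s₃ ∷ s₄ ∷ s₅ ∷ []) [] (b₁ ∷ b₂ ∷ b₃ ∷ b₄ ∷ [])
  hexagon? j (s₀ ∷ s₁ ∷ s₂ ∷ s₃ ∷ s₄ ∷ s₅ ∷ []) (true ∷ false ∷ b₂ ∷ b₃ ∷ b₄ ∷ true ∷ []) =
    broken-cycle? j (s₀ ∷ s₁ ∷ []) (s₂ ∷ s₃ ∷ s₄ ∷ s₅ ∷ []) (true ∷ []) (b₂ ∷ b₃ ∷ b₄ ∷ [])
  hexagon? j (s₀ ∷ s₁ ∷ s₂ ∷ s₃ ∷ s₄ ∷ s₅ ∷ []) (true ∷ true ∷ false ∷ b₃ ∷ b₄ ∷ true ∷ []) =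
    broken-cycle? j (s₀ ∷ s₁ ∷ s₂ ∷ []) (s₃ ∷ s₄ ∷ s₅ ∷ []) (true ∷ true ∷ []) (b₃ ∷ b₄ ∷ [])
  hexagon? j (s₀ ∷ s₁ ∷ s₂ ∷ s₃ ∷ s₄ ∷ s₅ ∷ []) (true ∷ true ∷ true ∷ false ∷ b₄ ∷ true ∷ []) =
    broken-cycle? j (s₀ ∷ s₁ ∷ s₂ ∷ s₃ ∷ []) (s₄ ∷ s₅ ∷ []) (true ∷ true ∷ true ∷ []) (b₄ ∷ [])
  hexagon? j (s₀ ∷ s₁ ∷ s₂ ∷ s₃ ∷ s₄ ∷ s₅ ∷ []) (true ∷ true ∷ true ∷ true ∷ false ∷ true ∷ []) =
    broken-cycle? j (s₀ ∷ s₁ ∷ s₂ ∷ s₃ ∷ s₄ ∷ []) (s₅ ∷ []) (true ∷ true ∷ true ∷ true ∷ []) []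
  hexagon? j s (true ∷ true ∷ true ∷ true ∷ true ∷ true ∷ []) = no (hexagon-cycle j)

open Hexagons

module Chains where

  open import Level using (0ℓ)
  open import Data.Nat using (ℕ; suc; _+_; _≤_)
  open import Data.Nat.Properties using (≤-refl; ≤-trans; 1+n≰n; m≤n+m; ≤-pred; +-monoˡ-≤)
  open import Data.Fin using (Fin; toℕ)
  open import Data.Fin.Properties using (toℕ≤pred[n])
  open import Data.Bool using (Bool; true; false; not; _∧_)
  open import Data.Bool.Properties using (_≟_)
  open import Data.Vec using (Vec)
  open import Data.List using (List; []; _∷_)
  open import Data.Product using (_×_; _,_; proj₂)
  open import Data.Product.Function.NonDependent.Propositional using (_×-⇔_)
  open import Data.Sum using (_⊎_; inj₁; inj₂; [_,_]′)
  open import Data.Empty using (⊥-elim)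
  open import Function.Bundles using (_⇔_; mk⇔; Equivalence)
  open import Function.Construct.Composition using (_⇔-∘_)
  open import Function.Construct.Identity using (⇔-id)
  open import Function.Construct.Symmetry using (⇔-sym)
  open import Relation.Nullary using (Dec)
  open import Relation.Nullary.Decidable using (map; _×-dec_)
  open import Relation.Unary using (Pred; Empty; _∪_)
  open import Relation.Binary.Core using (Rel)
  open import Relation.Binary.Definitions using (Symmetric)
  open import Relation.Binary.PropositionalEquality using (_≡_; refl)

  open Equivalence using (to; from)

  -- A chain starting at vertex j is given by the offsets o of its cut edges: hexagon i occupies
  -- j + 6i, …, j + 6i + 5, and its cut edge joins j + 6i + o to the first vertex of hexagon i + 1.
  Exits : Set
  Exits = List (Fin 6)

  VertexMarks : Exits → Set
  VertexMarks []       = Vec Bool 6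
  VertexMarks (_ ∷ os) = Vec Bool 6 × VertexMarks os

  EdgeMarks : Exits → Set
  EdgeMarks []       = Vec Bool 6
  EdgeMarks (_ ∷ os) = Vec Bool 6 × Bool × EdgeMarks os

  ChainVertices : ℕ → ∀ os → VertexMarks os → Pred ℕ 0ℓ
  ChainVertices j []       s        = Marked j s
  ChainVertices j (_ ∷ os) (s , ss) = Marked j s ∪ ChainVertices (6 + j) os ss

  ChainEdges : ℕ → ∀ os → EdgeMarks os → Rel ℕ 0ℓ
  ChainEdges j []       f              u v = HexEdges j f u v
  ChainEdges j (o ∷ os) (f , c , fs) u v =
    HexEdges j f u v ⊎ (c ≡ true × Joins (toℕ o + j) (6 + j) u v) ⊎ ChainEdges (6 + j) os fs u v

  ChainEdges-sym : ∀ j os fs → Symmetric (ChainEdges j os fs)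
  ChainEdges-sym j []       f            e                      = HexEdges-sym j f e
  ChainEdges-sym j (o ∷ os) (f , c , fs) (inj₁ e)               = inj₁ (HexEdges-sym j f e)
  ChainEdges-sym j (o ∷ os) (f , c , fs) (inj₂ (inj₁ (t , uv))) = inj₂ (inj₁ (t , Joins-sym uv))
  ChainEdges-sym j (o ∷ os) (f , c , fs) (inj₂ (inj₂ e))        = inj₂ (inj₂ (ChainEdges-sym (6 + j) os fs e))

  ChainVertices-lower : ∀ j os ss {x} → ChainVertices j os ss x → j ≤ x
  ChainVertices-lower j []       s        p        = Marked-lower j s p
  ChainVertices-lower j (o ∷ os) (s , ss) (inj₁ p) = Marked-lower j s p
  ChainVertices-lower j (o ∷ os) (s , ss) (inj₂ p) = ≤-trans (m≤n+m j 6) (ChainVertices-lower (6 + j) os ss p)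

  ChainEdges-lower : ∀ j os fs {u v} → ChainEdges j os fs u v → j ≤ u × j ≤ v
  ChainEdges-lower j []       f            e = HexEdges-lower j f e
  ChainEdges-lower j (o ∷ os) (f , c , fs) (inj₁ e) = HexEdges-lower j f e
  ChainEdges-lower j (o ∷ os) (f , c , fs) (inj₂ (inj₁ (_ , inj₁ (refl , refl)))) = m≤n+m j (toℕ o) , m≤n+m j 6
  ChainEdges-lower j (o ∷ os) (f , c , fs) (inj₂ (inj₁ (_ , inj₂ (refl , refl)))) = m≤n+m j 6 , m≤n+m j (toℕ o)
  ChainEdges-lower j (o ∷ os) (f , c , fs) (inj₂ (inj₂ e)) =
    let (u≥ , v≥) = ChainEdges-lower (6 + j) os fs e in ≤-trans (m≤n+m j 6) u≥ , ≤-trans (m≤n+m j 6) v≥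

  root : ∀ {os} → VertexMarks os → Bool
  root {[]}    s       = bitAt s 0
  root {_ ∷ _} (s , _) = bitAt s 0

  ChainVertices-root : ∀ j os ss → ChainVertices j os ss j ⇔ (root ss ≡ true)
  ChainVertices-root j []       s        = Marked-at j s 0
  ChainVertices-root j (o ∷ os) (s , ss) = mk⇔
    [ to (Marked-at j s 0) , (λ p → ⊥-elim (1+n≰n (≤-trans (m≤n+m (suc j) 5) (ChainVertices-lower (6 + j) os ss p)))) ]′
    (λ r → inj₁ (from (Marked-at j s 0) r))

  allFalseᵛ : ∀ {os} → VertexMarks os → Bool
  allFalseᵛ {[]}    s        = allFalse s
  allFalseᵛ {_ ∷ _} (s , ss) = allFalse s ∧ allFalseᵛ ss

  allFalseᵉ : ∀ {os} → EdgeMarks os → Bool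
  allFalseᵉ {[]}    f            = allFalse f
  allFalseᵉ {_ ∷ _} (f , c , fs) = allFalse f ∧ (not c ∧ allFalseᵉ fs)

  private
    ∧-true : ∀ a b → (a ∧ b ≡ true) ⇔ (a ≡ true × b ≡ true)
    ∧-true true  b = mk⇔ (λ b≡true → refl , b≡true) proj₂
    ∧-true false b = mk⇔ (λ ()) (λ { (() , _) })

    Empty-∪ : ∀ {P Q : Pred ℕ 0ℓ} → Empty (P ∪ Q) ⇔ (Empty P × Empty Q)
    Empty-∪ = mk⇔ (λ e → (λ x p → e x (inj₁ p)) , (λ x q → e x (inj₂ q))) (λ (eP , eQ) x → [ eP x , eQ x ]′)

    Edgeless-⊎ : ∀ {R S : Rel ℕ 0ℓ} → Edgeless (λ u v → R u v ⊎ S u v) ⇔ (Edgeless R × Edgeless S)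
    Edgeless-⊎ = mk⇔ (λ e → (λ u v r → e u v (inj₁ r)) , (λ u v s → e u v (inj₂ s))) (λ (eR , eS) u v → [ eR u v , eS u v ]′)

    no-cut : ∀ c {a b} → Edgeless (λ u v → c ≡ true × Joins a b u v) ⇔ (not c ≡ true)
    no-cut true  {a} {b} = mk⇔ (λ e → ⊥-elim (e a b (refl , inj₁ (refl , refl)))) (λ ())
    no-cut false         = mk⇔ (λ _ → refl) (λ _ → λ { _ _ (() , _) })

  ChainVertices-empty : ∀ j os ss → Empty (ChainVertices j os ss) ⇔ (allFalseᵛ ss ≡ true)
  ChainVertices-empty j []       s        = Marked-empty j s
  ChainVertices-empty j (o ∷ os) (s , ss) =
    ⇔-sym (∧-true _ _) ⇔-∘ ((Marked-empty j s ×-⇔ ChainVertices-empty (6 + j) os ss) ⇔-∘ Empty-∪)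

  ChainEdges-empty : ∀ j os fs → Edgeless (ChainEdges j os fs) ⇔ (allFalseᵉ fs ≡ true)
  ChainEdges-empty j []       f            = HexEdges-empty j f
  ChainEdges-empty j (o ∷ os) (f , c , fs) =
    (⇔-sym (∧-true _ _) ⇔-∘ (⇔-id _ ×-⇔ ⇔-sym (∧-true _ _)))
    ⇔-∘ ((HexEdges-empty j f ×-⇔ ((no-cut c ×-⇔ ChainEdges-empty (6 + j) os fs) ⇔-∘ Edgeless-⊎)) ⇔-∘ Edgeless-⊎)

  chain? : ∀ j os (ss : VertexMarks os) (fs : EdgeMarks os) → Dec (IsTreeOn (ChainVertices j os ss) (ChainEdges j os fs))
  chain? j []       s        f            = hexagon? j s f
  chain? j (o ∷ os) (s , ss) (f , c , fs) = glued c
    where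
      hexagon≤ : ∀ {x} → Marked j s x → x ≤ 5 + j
      hexagon≤ p = ≤-pred (Marked-upper j s p)

      module G = Glue (HexEdges-sym j f) (ChainEdges-sym (6 + j) os fs) (5 + j)
                   hexagon≤ (ChainVertices-lower (6 + j) os ss)
                   (HexEdges-upper j f) (ChainEdges-lower (6 + j) os fs)
                   (+-monoˡ-≤ j (toℕ≤pred[n] o)) ≤-refl

      glued : ∀ c → Dec (IsTreeOn (ChainVertices j (o ∷ os) (s , ss)) (ChainEdges j (o ∷ os) (f , c , fs)))
      glued true  = G.joined? (hexagon? j s f) (chain? (6 + j) os ss fs) (Marked-at? j s (toℕ o))
                      (map (⇔-sym (ChainVertices-root (6 + j) os ss)) (root ss ≟ true))
      glued false = G.separate? (hexagon? j s f) (chain? (6 + j) os ss fs)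
                      (Marked-empty? j s ×-dec map (⇔-sym (HexEdges-empty j f)) (allFalse f ≟ true))
                      (map (⇔-sym (ChainVertices-empty (6 + j) os ss)) (allFalseᵛ ss ≟ true) ×-dec
                       map (⇔-sym (ChainEdges-empty (6 + j) os fs)) (allFalseᵉ fs ≟ true))

open Chains

module Sums where

  open import Data.Nat using (ℕ; zero; suc; _+_; _*_)
  open import Data.Nat.Properties using (+-assoc; +-comm; +-identityʳ; *-distribˡ-+; *-comm; *-zeroʳ)
  open import Data.Bool using (Bool; true; false)
  open import Data.Vec using (Vec; []; _∷_; _++_)
  open import Data.List using (List; []; _∷_; map; cartesianProduct) renaming (_++_ to _++ₗ_)
  open import Data.Product using (_,_)
  open import Relation.Binary.PropositionalEquality using (_≡_; refl; sym; trans; cong; cong₂)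
  open import Relation.Binary.PropositionalEquality.Properties using (module ≡-Reasoning)

  private
    variable
      A B : Set

  ∑ : List A → (A → ℕ) → ℕ
  ∑ []       f = 0
  ∑ (x ∷ xs) f = f x + ∑ xs f

  syntax ∑ xs (λ x → e) = ∑[ x ← xs ] e

  ∑-cong : ∀ (xs : List A) {f g : A → ℕ} → (∀ x → f x ≡ g x) → ∑ xs f ≡ ∑ xs g
  ∑-cong []       f≡g = refl
  ∑-cong (x ∷ xs) f≡g = cong₂ _+_ (f≡g x) (∑-cong xs f≡g)

  ∑-zero : ∀ (xs : List A) → ∑[ x ← xs ] 0 ≡ 0
  ∑-zero []       = refl
  ∑-zero (x ∷ xs) = ∑-zero xs

  ∑-++ : ∀ (xs ys : List A) f → ∑ (xs ++ₗ ys) f ≡ ∑ xs f + ∑ ys f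
  ∑-++ []       ys f = refl
  ∑-++ (x ∷ xs) ys f = trans (cong (f x +_) (∑-++ xs ys f)) (sym (+-assoc (f x) _ _))

  ∑-map : ∀ (g : A → B) xs f → ∑ (map g xs) f ≡ ∑[ x ← xs ] f (g x)
  ∑-map g []       f = refl
  ∑-map g (x ∷ xs) f = cong (f (g x) +_) (∑-map g xs f)

  ∑-+ : ∀ (xs : List A) f g → ∑[ x ← xs ] (f x + g x) ≡ ∑ xs f + ∑ xs g
  ∑-+ []       f g = refl
  ∑-+ (x ∷ xs) f g = begin
    f x + g x + ∑[ x ← xs ] (f x + g x) ≡⟨ cong (f x + g x +_) (∑-+ xs f g) ⟩
    f x + g x + (∑ xs f + ∑ xs g)       ≡⟨ +-assoc (f x) (g x) _ ⟩
    f x + (g x + (∑ xs f + ∑ xs g))     ≡⟨ cong (f x +_) (sym (+-assoc (g x) _ _)) ⟩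
    f x + (g x + ∑ xs f + ∑ xs g)       ≡⟨ cong (λ z → f x + (z + ∑ xs g)) (+-comm (g x) _) ⟩
    f x + (∑ xs f + g x + ∑ xs g)       ≡⟨ cong (f x +_) (+-assoc (∑ xs f) _ _) ⟩
    f x + (∑ xs f + (g x + ∑ xs g))     ≡⟨ sym (+-assoc (f x) _ _) ⟩
    f x + ∑ xs f + (g x + ∑ xs g)       ∎
    where open ≡-Reasoning

  ∑-*ˡ : ∀ (xs : List A) c f → ∑[ x ← xs ] (c * f x) ≡ c * ∑ xs f
  ∑-*ˡ []       c f = sym (*-zeroʳ c)
  ∑-*ˡ (x ∷ xs) c f = trans (cong (c * f x +_) (∑-*ˡ xs c f)) (sym (*-distribˡ-+ c (f x) _))

  ∑-*ʳ : ∀ (xs : List A) c f → ∑[ x ← xs ] (f x * c) ≡ ∑ xs f * c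
  ∑-*ʳ xs c f = trans (∑-cong xs (λ x → *-comm (f x) c)) (trans (∑-*ˡ xs c f) (*-comm c _))

  ∑-cartesianProduct : ∀ (xs : List A) (ys : List B) f →
                       ∑ (cartesianProduct xs ys) f ≡ ∑[ x ← xs ] ∑[ y ← ys ] f (x , y)
  ∑-cartesianProduct []       ys f = refl
  ∑-cartesianProduct (x ∷ xs) ys f =
    trans (∑-++ (map (x ,_) ys) (cartesianProduct xs ys) f)
          (cong₂ _+_ (∑-map (x ,_) ys f) (∑-cartesianProduct xs ys f))

  ∑-comm : ∀ (xs : List A) (ys : List B) (f : A → B → ℕ) → ∑[ x ← xs ] ∑[ y ← ys ] f x y ≡ ∑[ y ← ys ] ∑[ x ← xs ] f x y
  ∑-comm []       ys f = sym (∑-zero ys)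
  ∑-comm (x ∷ xs) ys f =
    trans (cong (∑ ys (f x) +_) (∑-comm xs ys f)) (sym (∑-+ ys (f x) (λ y → ∑[ x ← xs ] f x y)))

  ∑-product : ∀ (xs : List A) (ys : List B) (f : A → ℕ) (g : B → ℕ) → ∑[ x ← xs ] ∑[ y ← ys ] (f x * g y) ≡ ∑ xs f * ∑ ys g
  ∑-product xs ys f g = trans (∑-cong xs (λ x → ∑-*ˡ ys (f x) g)) (∑-*ʳ xs (∑ ys g) f)

  opaque
    booleanVectors : ∀ n → List (Vec Bool n)
    booleanVectors zero    = [] ∷ []
    booleanVectors (suc n) = map (true ∷_) (booleanVectors n) ++ₗ map (false ∷_) (booleanVectors n)

  opaque
    unfolding booleanVectors

    ∑-booleanVectors-zero : ∀ f → ∑ (booleanVectors 0) f ≡ f []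
    ∑-booleanVectors-zero f = +-identityʳ (f [])

    ∑-booleanVectors-suc : ∀ n f → ∑ (booleanVectors (suc n)) f ≡
                           ∑[ v ← booleanVectors n ] f (true ∷ v) + ∑[ v ← booleanVectors n ] f (false ∷ v)
    ∑-booleanVectors-suc n f =
      trans (∑-++ (map (true ∷_) (booleanVectors n)) (map (false ∷_) (booleanVectors n)) f)
            (cong₂ _+_ (∑-map (true ∷_) (booleanVectors n) f) (∑-map (false ∷_) (booleanVectors n) f))

  ∑-booleanVectors-++ : ∀ m n f → ∑ (booleanVectors (m + n)) f ≡
                        ∑[ u ← booleanVectors m ] ∑[ v ← booleanVectors n ] f (u ++ v)
  ∑-booleanVectors-++ zero    n f = sym (∑-booleanVectors-zero (λ u → ∑[ v ← booleanVectors n ] f (u ++ v)))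
  ∑-booleanVectors-++ (suc m) n f =
    trans (∑-booleanVectors-suc (m + n) f)
          (trans (cong₂ _+_ (∑-booleanVectors-++ m n (λ v → f (true ∷ v))) (∑-booleanVectors-++ m n (λ v → f (false ∷ v))))
                 (sym (∑-booleanVectors-suc m (λ u → ∑[ v ← booleanVectors n ] f (u ++ v)))))

  ∑-+₄ : ∀ {C D : Set} (xs : List A) (ys : List B) (zs : List C) (ws : List D) (f g : A → B → C → D → ℕ) →
         ∑[ x ← xs ] ∑[ y ← ys ] ∑[ z ← zs ] ∑[ w ← ws ] (f x y z w + g x y z w) ≡
         ∑[ x ← xs ] ∑[ y ← ys ] ∑[ z ← zs ] ∑[ w ← ws ] f x y z w + ∑[ x ← xs ] ∑[ y ← ys ] ∑[ z ← zs ] ∑[ w ← ws ] g x y z w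
  ∑-+₄ xs ys zs ws f g =
    trans (∑-cong xs (λ x → trans (∑-cong ys (λ y → trans (∑-cong zs (λ z → ∑-+ ws (f x y z) (g x y z)))
                                                           (∑-+ zs _ _)))
                                  (∑-+ ys _ _)))
          (∑-+ xs _ _)

  ∑-product₄ : ∀ {C D : Set} (xs : List A) (ys : List B) (zs : List C) (ws : List D) (f : A → C → ℕ) (g : B → D → ℕ) →
               ∑[ x ← xs ] ∑[ y ← ys ] ∑[ z ← zs ] ∑[ w ← ws ] (f x z * g y w) ≡
               ∑[ x ← xs ] ∑[ z ← zs ] f x z * ∑[ y ← ys ] ∑[ w ← ws ] g y w
  ∑-product₄ xs ys zs ws f g = begin
    ∑[ x ← xs ] ∑[ y ← ys ] ∑[ z ← zs ] ∑[ w ← ws ] (f x z * g y w)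
      ≡⟨ ∑-cong xs (λ x → ∑-comm ys zs (λ y z → ∑[ w ← ws ] (f x z * g y w))) ⟩
    ∑[ x ← xs ] ∑[ z ← zs ] ∑[ y ← ys ] ∑[ w ← ws ] (f x z * g y w)
      ≡⟨ ∑-cong xs (λ x → ∑-cong zs (λ z → trans (∑-cong ys (λ y → ∑-*ˡ ws (f x z) (g y))) (∑-*ˡ ys (f x z) _))) ⟩
    ∑[ x ← xs ] ∑[ z ← zs ] (f x z * G)
      ≡⟨ ∑-cong xs (λ x → ∑-*ʳ zs G (f x)) ⟩
    ∑[ x ← xs ] (∑[ z ← zs ] f x z * G)
      ≡⟨ ∑-*ʳ xs G (λ x → ∑[ z ← zs ] f x z) ⟩
    ∑[ x ← xs ] ∑[ z ← zs ] f x z * G ∎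
    where
      open ≡-Reasoning
      G = ∑[ y ← ys ] ∑[ w ← ws ] g y w

open Sums

module Counting where

  open import Data.Nat using (ℕ; zero; suc; _+_; _*_)
  open import Data.Nat.Properties using (+-identityʳ; *-comm)
  open import Data.Nat.Solver using (module +-*-Solver)
  open import Data.Fin using (Fin; zero; suc; toℕ)
  open import Data.Bool using (Bool; true; false; not; _∧_; _∨_)
  open import Data.Bool.Properties using (_≟_)
  open import Data.Vec using (Vec)
  open import Data.List using (List; []; _∷_; cartesianProduct)
  open import Data.Product using (_×_; _,_; proj₁; proj₂)
  open import Data.Empty using (⊥-elim)
  open import Function.Bundles using (Equivalence)
  open import Relation.Nullary using (Dec; yes; no; does)
  open import Relation.Binary.PropositionalEquality using (_≡_; refl; sym; trans; cong; cong₂)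
  open import Relation.Binary.PropositionalEquality.Properties using (module ≡-Reasoning)

  open +-*-Solver using (solve; _:+_; _:*_; _:=_; con)
  open ≡-Reasoning

  fromBool : Bool → ℕ
  fromBool true  = 1
  fromBool false = 0

  ⟦_⟧ : ∀ {A : Set} → Dec A → ℕ
  ⟦ d ⟧ = fromBool (does d)

  fromBool-∧ : ∀ a b → fromBool (a ∧ b) ≡ fromBool a * fromBool b
  fromBool-∧ true  b = sym (+-identityʳ (fromBool b))
  fromBool-∧ false b = refl

  fromBool-exclusive : ∀ a b c d e → (a ≡ true → d ≡ false) →
                       fromBool ((a ∧ b) ∨ (c ∧ (d ∧ e))) ≡ fromBool a * fromBool b + fromBool c * (fromBool d * fromBool e)
  fromBool-exclusive false b c d     e _ = trans (fromBool-∧ c (d ∧ e)) (cong (fromBool c *_) (fromBool-∧ d e))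
  fromBool-exclusive true  b c true  e a⇒¬d with a⇒¬d refl
  ... | ()
  fromBool-exclusive true  true  true  false e _ = refl
  fromBool-exclusive true  true  false false e _ = refl
  fromBool-exclusive true  false true  false e _ = refl
  fromBool-exclusive true  false false false e _ = refl

  true-yields : ∀ {A : Set} (d : Dec A) → does d ≡ true → A
  true-yields (yes a) _ = a
  true-yields (no _)  ()

  ∑-fromBool-∧ : ∀ {A B : Set} (xs : List A) (ys : List B) (f : A → Bool) (g : B → Bool) →
                 ∑ (cartesianProduct xs ys) (λ (x , y) → fromBool (f x ∧ g y)) ≡
                 ∑[ x ← xs ] fromBool (f x) * ∑[ y ← ys ] fromBool (g y)
  ∑-fromBool-∧ xs ys f g = begin
    ∑ (cartesianProduct xs ys) (λ (x , y) → fromBool (f x ∧ g y))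
      ≡⟨ ∑-cartesianProduct xs ys _ ⟩
    ∑[ x ← xs ] ∑[ y ← ys ] fromBool (f x ∧ g y)
      ≡⟨ ∑-cong xs (λ x → ∑-cong ys (λ y → fromBool-∧ (f x) (g y))) ⟩
    ∑[ x ← xs ] ∑[ y ← ys ] (fromBool (f x) * fromBool (g y))
      ≡⟨ ∑-product xs ys _ _ ⟩
    ∑[ x ← xs ] fromBool (f x) * ∑[ y ← ys ] fromBool (g y) ∎

  does-≟-true : ∀ b → does (b ≟ true) ≡ b
  does-≟-true true  = refl
  does-≟-true false = refl

  -- Opaque, so that the 64 markings of a hexagon are unfolded only where counts over them are evaluated.
  opaque
    unfolding booleanVectors

    hexagonMarks : List (Vec Bool 6)
    hexagonMarks = booleanVectors 6

    hexagonMarks≡ : hexagonMarks ≡ booleanVectors 6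
    hexagonMarks≡ = refl

  vertexMarkings : ∀ os → List (VertexMarks os)
  vertexMarkings []       = hexagonMarks
  vertexMarkings (_ ∷ os) = cartesianProduct hexagonMarks (vertexMarkings os)

  edgeMarkings : ∀ os → List (EdgeMarks os)
  edgeMarkings []       = hexagonMarks
  edgeMarkings (_ ∷ os) = cartesianProduct hexagonMarks (cartesianProduct (true ∷ false ∷ []) (edgeMarkings os))

  treeCount : ℕ → Exits → ℕ
  treeCount j os = ∑[ ss ← vertexMarkings os ] ∑[ fs ← edgeMarkings os ] ⟦ chain? j os ss fs ⟧

  rootedTreeCount : ℕ → Exits → ℕ
  rootedTreeCount j os = ∑[ ss ← vertexMarkings os ] ∑[ fs ← edgeMarkings os ] (fromBool (root ss) * ⟦ chain? j os ss fs ⟧)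

  -- the number of subtrees of a hexagon containing its vertices 0 and o
  throughBoth : Fin 6 → ℕ
  throughBoth zero                               = 21
  throughBoth (suc zero)                         = 16
  throughBoth (suc (suc zero))                   = 13
  throughBoth (suc (suc (suc zero)))             = 12
  throughBoth (suc (suc (suc (suc zero))))       = 13
  throughBoth (suc (suc (suc (suc (suc zero))))) = 16

  stn₀ stn : Exits → ℕ
  stn₀ []       = 21
  stn₀ (o ∷ os) = 21 + throughBoth o * stn₀ os
  stn  []       = 36
  stn  (o ∷ os) = 36 + stn os + 21 * stn₀ os

  ∑∑ : (Vec Bool 6 → Vec Bool 6 → ℕ) → ℕ
  ∑∑ F = ∑[ s ← hexagonMarks ] ∑[ f ← hexagonMarks ] F s f

  opaque
    unfolding hexagonMarks

    one-empty-hexagon : ∑[ s ← hexagonMarks ] fromBool (allFalse s) ≡ 1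
    one-empty-hexagon = refl

  one-empty-vertexMarking : ∀ os → ∑[ ss ← vertexMarkings os ] fromBool (allFalseᵛ ss) ≡ 1
  one-empty-vertexMarking []       = one-empty-hexagon
  one-empty-vertexMarking (o ∷ os) =
    trans (∑-fromBool-∧ hexagonMarks (vertexMarkings os) allFalse allFalseᵛ)
          (cong₂ _*_ one-empty-hexagon (one-empty-vertexMarking os))

  one-empty-edgeMarking : ∀ os → ∑[ fs ← edgeMarkings os ] fromBool (allFalseᵉ fs) ≡ 1
  one-empty-edgeMarking []       = one-empty-hexagon
  one-empty-edgeMarking (o ∷ os) =
    trans (∑-fromBool-∧ hexagonMarks (cartesianProduct (true ∷ false ∷ []) (edgeMarkings os)) allFalse cut-free)
          (cong₂ _*_ one-empty-hexagon
                 (trans (∑-fromBool-∧ (true ∷ false ∷ []) (edgeMarkings os) not allFalseᵉ)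
                        (cong (_+ 0) (one-empty-edgeMarking os))))
    where
      cut-free : Bool × EdgeMarks os → Bool
      cut-free (c , fs) = not c ∧ allFalseᵉ fs

  hexagon-nonempty : ∀ j s f → does (hexagon? j s f) ≡ true → allFalse s ≡ false
  hexagon-nonempty j s f tree with allFalse s in none
  ... | false = refl
  ... | true  = let (x , p) = nonempty (true-yields (hexagon? j s f) tree)
                in ⊥-elim (Equivalence.from (Marked-empty j s) none x p)

  module FirstHexagon (j : ℕ) (o : Fin 6) (os : Exits) where

    tree : Vec Bool 6 → Vec Bool 6 → Bool
    tree s f = does (hexagon? j s f)

    tree′ : VertexMarks os → EdgeMarks os → Bool
    tree′ ss fs = does (chain? (6 + j) os ss fs)

    treeAtExit treeHere emptyHere : Vec Bool 6 → Vec Bool 6 → ℕ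
    treeAtExit s f = fromBool (tree s f) * fromBool (bitAt s (toℕ o))
    treeHere   s f = fromBool (tree s f)
    emptyHere  s f = fromBool (allFalse s) * fromBool (allFalse f)

    treeAtRoot emptyRest treeRest : VertexMarks os → EdgeMarks os → ℕ
    treeAtRoot ss fs = fromBool (root ss) * fromBool (tree′ ss fs)
    emptyRest  ss fs = fromBool (allFalseᵛ ss) * fromBool (allFalseᵉ fs)
    treeRest   ss fs = fromBool (tree′ ss fs)

    indicator : Vec Bool 6 → VertexMarks os → Vec Bool 6 → Bool → EdgeMarks os → ℕ
    indicator s ss f c fs = ⟦ chain? j (o ∷ os) (s , ss) (f , c , fs) ⟧

    indicator-cut : ∀ s ss f fs → indicator s ss f true fs ≡ treeAtExit s f * treeAtRoot ss fs
    indicator-cut s ss f fs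
      rewrite does-≟-true (bitAt s (toℕ o)) | does-≟-true (root ss)
            | fromBool-∧ (tree s f ∧ tree′ ss fs) (bitAt s (toℕ o) ∧ root ss)
            | fromBool-∧ (tree s f) (tree′ ss fs) | fromBool-∧ (bitAt s (toℕ o)) (root ss) =
      solve 4 (λ t t′ x r → (t :* t′) :* (x :* r) := (t :* x) :* (r :* t′)) refl
        (fromBool (tree s f)) (fromBool (tree′ ss fs)) (fromBool (bitAt s (toℕ o))) (fromBool (root ss))

    indicator-no-cut : ∀ s ss f fs → indicator s ss f false fs ≡ treeHere s f * emptyRest ss fs + emptyHere s f * treeRest ss fs
    indicator-no-cut s ss f fs
      rewrite does-≟-true (allFalseᵛ ss) | does-≟-true (allFalseᵉ fs) | does-≟-true (allFalse s) | does-≟-true (allFalse f)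
            | fromBool-exclusive (tree s f) (allFalseᵛ ss ∧ allFalseᵉ fs) (tree′ ss fs) (allFalse s) (allFalse f)
                                 (hexagon-nonempty j s f)
            | fromBool-∧ (allFalseᵛ ss) (allFalseᵉ fs) =
      cong (treeHere s f * emptyRest ss fs +_) (*-comm (fromBool (tree′ ss fs)) _)

    ∑ʳ : (VertexMarks os → EdgeMarks os → ℕ) → ℕ
    ∑ʳ G = ∑[ ss ← vertexMarkings os ] ∑[ fs ← edgeMarkings os ] G ss fs

    module Weighted (α : Vec Bool 6 → ℕ) where

      ∑₄ : (Vec Bool 6 → VertexMarks os → Vec Bool 6 → EdgeMarks os → ℕ) → ℕ
      ∑₄ h = ∑[ s ← hexagonMarks ] ∑[ ss ← vertexMarkings os ] ∑[ f ← hexagonMarks ] ∑[ fs ← edgeMarkings os ] h s ss f fs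

      h₁ h₂ h₃ : Vec Bool 6 → VertexMarks os → Vec Bool 6 → EdgeMarks os → ℕ
      h₁ s ss f fs = (α s * treeAtExit s f) * treeAtRoot ss fs
      h₂ s ss f fs = (α s * treeHere s f) * emptyRest ss fs
      h₃ s ss f fs = (α s * emptyHere s f) * treeRest ss fs

      both-cuts : ∀ s ss f fs → α s * indicator s ss f true fs + α s * indicator s ss f false fs
                                ≡ h₁ s ss f fs + (h₂ s ss f fs + h₃ s ss f fs)
      both-cuts s ss f fs = begin
        α s * indicator s ss f true fs + α s * indicator s ss f false fs
          ≡⟨ cong₂ (λ x y → α s * x + α s * y) (indicator-cut s ss f fs) (indicator-no-cut s ss f fs) ⟩
        α s * (treeAtExit s f * treeAtRoot ss fs)
          + α s * (treeHere s f * emptyRest ss fs + emptyHere s f * treeRest ss fs)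
          ≡⟨ solve 7 (λ a x₁ y₁ x₂ y₂ x₃ y₃ → a :* (x₁ :* y₁) :+ a :* (x₂ :* y₂ :+ x₃ :* y₃)
                                             := (a :* x₁) :* y₁ :+ ((a :* x₂) :* y₂ :+ (a :* x₃) :* y₃)) refl
                   (α s) (treeAtExit s f) (treeAtRoot ss fs) (treeHere s f) (emptyRest ss fs)
                   (emptyHere s f) (treeRest ss fs) ⟩
        h₁ s ss f fs + (h₂ s ss f fs + h₃ s ss f fs) ∎

      sum-cuts : ∀ s ss f → ∑[ c ← true ∷ false ∷ [] ] ∑[ fs ← edgeMarkings os ] (α s * indicator s ss f c fs)
                            ≡ ∑[ fs ← edgeMarkings os ] (h₁ s ss f fs + (h₂ s ss f fs + h₃ s ss f fs))
      sum-cuts s ss f = begin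
        ∑[ fs ← edgeMarkings os ] (α s * indicator s ss f true fs)
          + (∑[ fs ← edgeMarkings os ] (α s * indicator s ss f false fs) + 0)
          ≡⟨ cong (∑[ fs ← edgeMarkings os ] (α s * indicator s ss f true fs) +_) (+-identityʳ _) ⟩
        ∑[ fs ← edgeMarkings os ] (α s * indicator s ss f true fs)
          + ∑[ fs ← edgeMarkings os ] (α s * indicator s ss f false fs)
          ≡⟨ sym (∑-+ (edgeMarkings os) _ _) ⟩
        ∑[ fs ← edgeMarkings os ] (α s * indicator s ss f true fs + α s * indicator s ss f false fs)
          ≡⟨ ∑-cong (edgeMarkings os) (both-cuts s ss f) ⟩
        ∑[ fs ← edgeMarkings os ] (h₁ s ss f fs + (h₂ s ss f fs + h₃ s ss f fs)) ∎

      separate : ∀ F G → ∑₄ (λ s ss f fs → F s f * G ss fs) ≡ ∑∑ F * ∑ʳ G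
      separate = ∑-product₄ hexagonMarks (vertexMarkings os) hexagonMarks (edgeMarkings os)

      weighted-count :
        ∑[ s ← hexagonMarks ] ∑[ ss ← vertexMarkings os ] ∑[ f ← hexagonMarks ] ∑[ c ← true ∷ false ∷ [] ]
          ∑[ fs ← edgeMarkings os ] (α s * indicator s ss f c fs)
        ≡ ∑∑ (λ s f → α s * treeAtExit s f) * ∑ʳ treeAtRoot
          + (∑∑ (λ s f → α s * treeHere s f) * ∑ʳ emptyRest + ∑∑ (λ s f → α s * emptyHere s f) * ∑ʳ treeRest)
      weighted-count = begin
        ∑[ s ← hexagonMarks ] ∑[ ss ← vertexMarkings os ] ∑[ f ← hexagonMarks ] ∑[ c ← true ∷ false ∷ [] ]
          ∑[ fs ← edgeMarkings os ] (α s * indicator s ss f c fs)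
          ≡⟨ ∑-cong hexagonMarks (λ s → ∑-cong (vertexMarkings os) (λ ss → ∑-cong hexagonMarks (λ f → sum-cuts s ss f))) ⟩
        ∑₄ (λ s ss f fs → h₁ s ss f fs + (h₂ s ss f fs + h₃ s ss f fs))
          ≡⟨ ∑-+₄ hexagonMarks (vertexMarkings os) hexagonMarks (edgeMarkings os) h₁ _ ⟩
        ∑₄ h₁ + ∑₄ (λ s ss f fs → h₂ s ss f fs + h₃ s ss f fs)
          ≡⟨ cong (∑₄ h₁ +_) (∑-+₄ hexagonMarks (vertexMarkings os) hexagonMarks (edgeMarkings os) h₂ h₃) ⟩
        ∑₄ h₁ + (∑₄ h₂ + ∑₄ h₃)
          ≡⟨ cong₂ _+_ (separate (λ s f → α s * treeAtExit s f) treeAtRoot)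
                       (cong₂ _+_ (separate (λ s f → α s * treeHere s f) emptyRest)
                                  (separate (λ s f → α s * emptyHere s f) treeRest)) ⟩
        ∑∑ (λ s f → α s * treeAtExit s f) * ∑ʳ treeAtRoot
          + (∑∑ (λ s f → α s * treeHere s f) * ∑ʳ emptyRest + ∑∑ (λ s f → α s * emptyHere s f) * ∑ʳ treeRest) ∎

    expand : ∀ (g : VertexMarks (o ∷ os) → EdgeMarks (o ∷ os) → ℕ) →
      ∑[ ss ← vertexMarkings (o ∷ os) ] ∑[ fs ← edgeMarkings (o ∷ os) ] g ss fs
      ≡ ∑[ s ← hexagonMarks ] ∑[ ss ← vertexMarkings os ] ∑[ f ← hexagonMarks ] ∑[ c ← true ∷ false ∷ [] ]
          ∑[ fs ← edgeMarkings os ] g (s , ss) (f , c , fs)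
    expand g =
      trans (∑-cartesianProduct hexagonMarks (vertexMarkings os) _)
            (∑-cong hexagonMarks (λ s → ∑-cong (vertexMarkings os) (λ ss →
              trans (∑-cartesianProduct hexagonMarks _ _)
                    (∑-cong hexagonMarks (λ f → ∑-cartesianProduct (true ∷ false ∷ []) (edgeMarkings os) _)))))

  opaque
    unfolding hexagonMarks

    trees-through-exit : ∀ j os o → ∑∑ (λ s f → 1 * FirstHexagon.treeAtExit j o os s f) ≡ 21
    trees-through-exit j os zero                               = refl
    trees-through-exit j os (suc zero)                         = refl
    trees-through-exit j os (suc (suc zero))                   = refl
    trees-through-exit j os (suc (suc (suc zero)))             = refl
    trees-through-exit j os (suc (suc (suc (suc zero))))       = refl
    trees-through-exit j os (suc (suc (suc (suc (suc zero))))) = refl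

    trees-through-root-and-exit : ∀ j os o → ∑∑ (λ s f → fromBool (bitAt s 0) * FirstHexagon.treeAtExit j o os s f) ≡ throughBoth o
    trees-through-root-and-exit j os zero                               = refl
    trees-through-root-and-exit j os (suc zero)                         = refl
    trees-through-root-and-exit j os (suc (suc zero))                   = refl
    trees-through-root-and-exit j os (suc (suc (suc zero)))             = refl
    trees-through-root-and-exit j os (suc (suc (suc (suc zero))))       = refl
    trees-through-root-and-exit j os (suc (suc (suc (suc (suc zero))))) = refl

    trees : ∀ j os o → ∑∑ (λ s f → 1 * FirstHexagon.treeHere j o os s f) ≡ 36
    trees j os o = refl

    trees-through-root : ∀ j os o → ∑∑ (λ s f → fromBool (bitAt s 0) * FirstHexagon.treeHere j o os s f) ≡ 21
    trees-through-root j os o = refl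

    empty : ∀ j os o → ∑∑ (λ s f → 1 * FirstHexagon.emptyHere j o os s f) ≡ 1
    empty j os o = refl

    empty-through-root : ∀ j os o → ∑∑ (λ s f → fromBool (bitAt s 0) * FirstHexagon.emptyHere j o os s f) ≡ 0
    empty-through-root j os o = refl

    single-hexagon : ∀ j → treeCount j [] ≡ 36 × rootedTreeCount j [] ≡ 21
    single-hexagon j = refl , refl

  counts : ∀ j os → treeCount j os ≡ stn os × rootedTreeCount j os ≡ stn₀ os
  counts j []       = single-hexagon j
  counts j (o ∷ os) = total , rooted
    where
      open FirstHexagon j o os
      ih = counts (6 + j) os

      one-empty-rest : ∑ʳ emptyRest ≡ 1
      one-empty-rest = trans (∑-product (vertexMarkings os) (edgeMarkings os) _ _)
                             (cong₂ _*_ (one-empty-vertexMarking os) (one-empty-edgeMarking os))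

      total : treeCount j (o ∷ os) ≡ stn (o ∷ os)
      total = begin
        treeCount j (o ∷ os)
          ≡⟨ expand _ ⟩
        ∑[ s ← hexagonMarks ] ∑[ ss ← vertexMarkings os ] ∑[ f ← hexagonMarks ] ∑[ c ← true ∷ false ∷ [] ]
          ∑[ fs ← edgeMarkings os ] indicator s ss f c fs
          ≡⟨ ∑-cong hexagonMarks (λ s → ∑-cong (vertexMarkings os) (λ ss → ∑-cong hexagonMarks (λ f →
               ∑-cong (true ∷ false ∷ []) (λ c → ∑-cong (edgeMarkings os) (λ fs → sym (+-identityʳ (indicator s ss f c fs))))))) ⟩
        ∑[ s ← hexagonMarks ] ∑[ ss ← vertexMarkings os ] ∑[ f ← hexagonMarks ] ∑[ c ← true ∷ false ∷ [] ]
          ∑[ fs ← edgeMarkings os ] (1 * indicator s ss f c fs)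
          ≡⟨ Weighted.weighted-count (λ _ → 1) ⟩
        ∑∑ (λ s f → 1 * treeAtExit s f) * ∑ʳ treeAtRoot
          + (∑∑ (λ s f → 1 * treeHere s f) * ∑ʳ emptyRest + ∑∑ (λ s f → 1 * emptyHere s f) * ∑ʳ treeRest)
          ≡⟨ cong₂ _+_ (cong₂ _*_ (trees-through-exit j os o) (proj₂ ih))
                       (cong₂ _+_ (cong₂ _*_ (trees j os o) one-empty-rest) (cong₂ _*_ (empty j os o) (proj₁ ih))) ⟩
        21 * stn₀ os + (36 * 1 + 1 * stn os)
          ≡⟨ solve 2 (λ t t₀ → con 21 :* t₀ :+ (con 36 :* con 1 :+ con 1 :* t) := con 36 :+ t :+ con 21 :* t₀) refl
                   (stn os) (stn₀ os) ⟩
        stn (o ∷ os) ∎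

      rooted : rootedTreeCount j (o ∷ os) ≡ stn₀ (o ∷ os)
      rooted = begin
        rootedTreeCount j (o ∷ os)
          ≡⟨ expand _ ⟩
        ∑[ s ← hexagonMarks ] ∑[ ss ← vertexMarkings os ] ∑[ f ← hexagonMarks ] ∑[ c ← true ∷ false ∷ [] ]
          ∑[ fs ← edgeMarkings os ] (fromBool (bitAt s 0) * indicator s ss f c fs)
          ≡⟨ Weighted.weighted-count (λ s → fromBool (bitAt s 0)) ⟩
        ∑∑ (λ s f → fromBool (bitAt s 0) * treeAtExit s f) * ∑ʳ treeAtRoot
          + (∑∑ (λ s f → fromBool (bitAt s 0) * treeHere s f) * ∑ʳ emptyRest
             + ∑∑ (λ s f → fromBool (bitAt s 0) * emptyHere s f) * ∑ʳ treeRest)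
          ≡⟨ cong₂ _+_ (cong₂ _*_ (trees-through-root-and-exit j os o) (proj₂ ih))
                       (cong₂ _+_ (cong₂ _*_ (trees-through-root j os o) one-empty-rest)
                                  (cong₂ _*_ (empty-through-root j os o) (proj₁ ih))) ⟩
        throughBoth o * stn₀ os + (21 * 1 + 0 * stn os)
          ≡⟨ solve 3 (λ b t t₀ → b :* t₀ :+ (con 21 :* con 1 :+ con 0 :* t) := con 21 :+ b :* t₀) refl
                   (throughBoth o) (stn os) (stn₀ os) ⟩
        stn₀ (o ∷ os) ∎

open Counting

module Graphs where

  open import Level using (0ℓ)
  open import Data.Nat using (ℕ; zero; suc; _≤_; s≤s; z≤n)
  open import Data.Nat.Properties using (suc-injective)
  open import Data.Fin using (Fin; zero; suc; toℕ)
  open import Data.Bool using (Bool; true)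
  open import Data.Vec using (Vec; []; _∷_; _[_]=_; here; there)
  open import Data.List using (List; []; _∷_; _++_; length; lookup; initLast; _∷ʳ′_)
  open import Data.List.Properties using (++-assoc)
  open import Data.List.Relation.Unary.Linked as Linked using (Linked; [-]; _∷_)
  open import Data.List.Relation.Unary.Unique.Propositional using (Unique)
  open import Data.Product using (∃; _×_; _,_)
  open import Data.Sum using (_⊎_; inj₁; inj₂)
  open import Data.Empty using (⊥; ⊥-elim)
  open import Function.Bundles using (_⇔_; mk⇔; Equivalence)
  open import Relation.Binary.Core using (Rel)
  open import Relation.Binary.PropositionalEquality using (_≡_; refl; sym; subst; cong)
  open import Relation.Binary.Construct.Closure.ReflexiveTransitive as Star using ()

  open import Defs

  open Equivalence using (to; from)

  MarkedEdges : (es : List (ℕ × ℕ)) → Vec Bool (length es) → Rel ℕ 0ℓ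
  MarkedEdges []            []       u v = ⊥
  MarkedEdges ((a , b) ∷ es) (c ∷ cs) u v = (c ≡ true × Joins a b u v) ⊎ MarkedEdges es cs u v

  MarkedEdges-sym : ∀ es cs {u v} → MarkedEdges es cs u v → MarkedEdges es cs v u
  MarkedEdges-sym []             []       ()
  MarkedEdges-sym ((a , b) ∷ es) (c ∷ cs) (inj₁ (t , uv)) = inj₁ (t , Joins-sym uv)
  MarkedEdges-sym ((a , b) ∷ es) (c ∷ cs) (inj₂ e)        = inj₂ (MarkedEdges-sym es cs e)

  ListedEdge : (es : List (ℕ × ℕ)) → Vec Bool (length es) → Rel ℕ 0ℓ
  ListedEdge es cs u v = ∃ λ e → cs [ e ]= true × (lookup es e ≡ (u , v) ⊎ lookup es e ≡ (v , u))

  ListedEdge⇔MarkedEdges : ∀ es (cs : Vec Bool (length es)) {u v} → ListedEdge es cs u v ⇔ MarkedEdges es cs u v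
  ListedEdge⇔MarkedEdges [] [] = mk⇔ (λ { (() , _) }) (λ ())
  ListedEdge⇔MarkedEdges ((a , b) ∷ es) (c ∷ cs) = mk⇔ found find
    where
      found : ∀ {u v} → ListedEdge ((a , b) ∷ es) (c ∷ cs) u v → MarkedEdges ((a , b) ∷ es) (c ∷ cs) u v
      found (zero  , here    , inj₁ refl) = inj₁ (refl , inj₁ (refl , refl))
      found (zero  , here    , inj₂ refl) = inj₁ (refl , inj₂ (refl , refl))
      found (suc e , there m , eq)        = inj₂ (to (ListedEdge⇔MarkedEdges es cs) (e , m , eq))

      find : ∀ {u v} → MarkedEdges ((a , b) ∷ es) (c ∷ cs) u v → ListedEdge ((a , b) ∷ es) (c ∷ cs) u v
      find (inj₁ (refl , inj₁ (refl , refl))) = zero , here , inj₁ refl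
      find (inj₁ (refl , inj₂ (refl , refl))) = zero , here , inj₂ refl
      find (inj₂ r) = let (e , m , eq) = from (ListedEdge⇔MarkedEdges es cs) r in suc e , there m , eq

  []=true⇔bitAt : ∀ {n} (S : Vec Bool n) a → (∃ λ (i : Fin n) → toℕ i ≡ a × S [ i ]= true) ⇔ (bitAt S a ≡ true)
  []=true⇔bitAt []      a       = mk⇔ (λ { (() , _) }) (λ ())
  []=true⇔bitAt (b ∷ S) zero    = mk⇔ (λ { (zero , _ , here) → refl ; (suc i , () , _) }) (λ { refl → zero , refl , here })
  []=true⇔bitAt (b ∷ S) (suc a) = mk⇔
    (λ { (zero , () , _) ; (suc i , e , there m) → to ([]=true⇔bitAt S a) (i , suc-injective e , m) })
    (λ e → let (i , e′ , m) = from ([]=true⇔bitAt S a) e in suc i , cong suc e′ , there m)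

  private
    Linked-snoc : ∀ {R : Rel ℕ 0ℓ} x ys v w → Linked R (x ∷ ys ++ v ∷ []) → R v w → Linked R (x ∷ ys ++ v ∷ w ∷ [])
    Linked-snoc x []       v w (r ∷ [-]) r′ = r ∷ r′ ∷ [-]
    Linked-snoc x (y ∷ ys) v w (r ∷ l)   r′ = r ∷ Linked-snoc y ys v w l r′

    Linked-unsnoc : ∀ {R : Rel ℕ 0ℓ} x ys v w → Linked R (x ∷ ys ++ v ∷ w ∷ []) → Linked R (x ∷ ys ++ v ∷ []) × R v w
    Linked-unsnoc x []       v w (r ∷ r′ ∷ [-]) = (r ∷ [-]) , r′
    Linked-unsnoc x (y ∷ ys) v w (r ∷ l)        = let (l′ , r′) = Linked-unsnoc y ys v w l in (r ∷ l′) , r′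

  module _ (G : Graph) (S : Vec Bool (V G)) (F : Vec Bool (length (E G))) where

    private
      P = λ a → bitAt S a ≡ true
      R = MarkedEdges (E G) F

      InS⇔ : ∀ {a} → InS G S F a ⇔ P a
      InS⇔ = []=true⇔bitAt S _

      AdjF⇔ : ∀ {u v} → AdjF G S F u v ⇔ R u v
      AdjF⇔ = ListedEdge⇔MarkedEdges (E G) F

      toIsTreeOn : IsTree G S F → IsTreeOn P R
      toIsTreeOn T = record
        { nonempty  = let (i , m) = IsTree.nonempty T in toℕ i , to InS⇔ (i , refl , m)
        ; closed    = closed′
        ; connected = λ pu pv → Star.map (to AdjF⇔) (IsTree.connected T _ _ (from InS⇔ pu) (from InS⇔ pv))
        ; acyclic   = acyclic′
        }
        where
          closed′ : ∀ {u v} → R u v → P u × P v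
          closed′ r with from AdjF⇔ r
          ... | e , m , eq with IsTree.closed T e m
          ...   | a , b with eq
          ...     | inj₁ refl = to InS⇔ a , to InS⇔ b
          ...     | inj₂ refl = to InS⇔ b , to InS⇔ a

          acyclic′ : ∀ {u v} ys → R u v → Unique (u ∷ ys ++ v ∷ []) → Linked R (u ∷ ys ++ v ∷ []) → ys ≡ []
          acyclic′ []       r uniq l = refl
          acyclic′ {u} {v} (y ∷ ys) r uniq l = ⊥-elim (IsTree.acyclic T u (y ∷ ys ++ v ∷ []) (s≤s (s≤s (three ys))) uniq
            (subst (Linked (AdjF G S F)) (sym (++-assoc (u ∷ y ∷ ys) (v ∷ []) (u ∷ [])))
                   (Linked.map (from AdjF⇔) (Linked-snoc u (y ∷ ys) v u l (MarkedEdges-sym (E G) F r)))))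
            where
              three : ∀ (zs : List ℕ) → 1 ≤ length (zs ++ v ∷ [])
              three []      = s≤s z≤n
              three (_ ∷ _) = s≤s z≤n

      fromIsTreeOn : IsTreeOn P R → IsTree G S F
      fromIsTreeOn T = record
        { nonempty  = let (a , p) = nonempty T ; (i , _ , m) = from InS⇔ p in i , m
        ; closed    = λ e m → let (pu , pv) = closed T (to AdjF⇔ (e , m , inj₁ refl)) in from InS⇔ pu , from InS⇔ pv
        ; connected = λ u v iu iv → Star.map (from AdjF⇔) (connected T (to InS⇔ iu) (to InS⇔ iv))
        ; acyclic   = acyclic′
        }
        where
          acyclic′ : ∀ (x : ℕ) (xs : List ℕ) → 3 ≤ length (x ∷ xs) → Unique (x ∷ xs) →
                     Linked (AdjF G S F) ((x ∷ xs) ++ (x ∷ [])) → ⊥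
          acyclic′ x xs long uniq cycle with initLast xs
          acyclic′ x .[] (s≤s ()) uniq cycle | []
          acyclic′ x .(ys ++ z ∷ []) long uniq cycle | ys ∷ʳ′ z with Linked-unsnoc x ys z x
                     (subst (Linked R) (cong (x ∷_) (++-assoc ys (z ∷ []) (x ∷ []))) (Linked.map (to AdjF⇔) cycle))
          ... | path , zx with acyclic T ys (MarkedEdges-sym (E G) F zx) uniq path
          acyclic′ x .([] ++ z ∷ []) (s≤s (s≤s ())) uniq cycle | [] ∷ʳ′ z | path , zx | refl

    IsTree⇔IsTreeOn : IsTree G S F ⇔ IsTreeOn (λ a → bitAt S a ≡ true) (MarkedEdges (E G) F)
    IsTree⇔IsTreeOn = mk⇔ toIsTreeOn fromIsTreeOn

open Graphs

module ChainGraphs where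

  open import Data.Nat using (ℕ; zero; suc; _+_; _*_; _<_; z≤n; s≤s)
  open import Data.Nat.Properties using (+-suc; *-suc; +-comm; +-assoc; +-identityʳ; ≤-trans; m≤m+n; +-monoʳ-<; +-cancelˡ-<)
  open import Data.Fin using (toℕ)
  open import Data.Bool using (Bool; true)
  open import Data.Vec using (Vec; []; _∷_; tabulate)
  open import Data.List using (List; []; _∷_; _++_; length; map)
  open import Data.Product using (∃; _×_; _,_; proj₁; proj₂)
  open import Data.Product.Function.NonDependent.Propositional using (_×-⇔_)
  open import Data.Sum using (_⊎_; inj₁; inj₂; [_,_]′)
  open import Data.Sum.Function.Propositional using (_⊎-⇔_)
  open import Data.Empty using (⊥; ⊥-elim)
  open import Function.Base using (_∘_)
  open import Function.Bundles using (_⇔_; mk⇔; Equivalence)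
  open import Function.Construct.Composition using (_⇔-∘_)
  open import Function.Construct.Identity using (⇔-id)
  open import Relation.Binary.PropositionalEquality using (_≡_; refl; sym; trans; subst; cong)

  open import Defs

  open Equivalence using (to; from)

  hexagonEdgeList : ℕ → ℕ → List (ℕ × ℕ)
  hexagonEdgeList i zero    = []
  hexagonEdgeList i (suc m) = hexEdges i ++ hexagonEdgeList (suc i) m

  cutEdgeList : ℕ → Exits → List (ℕ × ℕ)
  cutEdgeList i os = cutEdges i (map toℕ os)

  chainGraph : Exits → Graph
  chainGraph os = record
    { V = 6 * suc (length os)
    ; E = hexagonEdgeList 0 (suc (length os)) ++ cutEdgeList 0 os
    }

  toVertexMarks : (ℕ → Bool) → ∀ os → VertexMarks os
  toVertexMarks σ []       = tabulate (σ ∘ toℕ)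
  toVertexMarks σ (_ ∷ os) = tabulate (σ ∘ toℕ) , toVertexMarks (λ a → σ (6 + a)) os

  Marked-tabulate : ∀ n σ j x → Marked j (tabulate {n = n} (σ ∘ toℕ)) x ⇔ (∃ λ a → x ≡ a + j × a < n × σ a ≡ true)
  Marked-tabulate zero    σ j x = mk⇔ (λ ()) (λ { (_ , _ , () , _) })
  Marked-tabulate (suc n) σ j x = mk⇔
    [ (λ (x≡j , bit) → 0 , x≡j , s≤s z≤n , bit)
    , (λ p → let (a , eq , a<n , bit) = to (Marked-tabulate n (σ ∘ suc) (suc j) x) p
             in suc a , trans eq (+-suc a j) , s≤s a<n , bit) ]′
    (λ { (zero , eq , _ , bit) → inj₁ (eq , bit)
       ; (suc a , eq , s≤s a<n , bit) →
           inj₂ (from (Marked-tabulate n (σ ∘ suc) (suc j) x) (a , trans eq (sym (+-suc a j)) , a<n , bit)) })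

  private
    below-or-above-6 : ∀ a → a < 6 ⊎ ∃ λ a′ → a ≡ 6 + a′
    below-or-above-6 0 = inj₁ (s≤s z≤n)
    below-or-above-6 1 = inj₁ (s≤s (s≤s z≤n))
    below-or-above-6 2 = inj₁ (s≤s (s≤s (s≤s z≤n)))
    below-or-above-6 3 = inj₁ (s≤s (s≤s (s≤s (s≤s z≤n))))
    below-or-above-6 4 = inj₁ (s≤s (s≤s (s≤s (s≤s (s≤s z≤n)))))
    below-or-above-6 5 = inj₁ (s≤s (s≤s (s≤s (s≤s (s≤s (s≤s z≤n))))))
    below-or-above-6 (suc (suc (suc (suc (suc (suc a′)))))) = inj₂ (a′ , refl)

    shift-6 : ∀ a j → (6 + a) + j ≡ a + (6 + j)
    shift-6 a j = trans (cong (_+ j) (+-comm 6 a)) (+-assoc a 6 j)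

  ChainVertices-tabulate : ∀ os σ j x →
    ChainVertices j os (toVertexMarks σ os) x ⇔ (∃ λ a → x ≡ a + j × a < 6 * suc (length os) × σ a ≡ true)
  ChainVertices-tabulate []       σ j x = Marked-tabulate 6 σ j x
  ChainVertices-tabulate (o ∷ os) σ j x = mk⇔
    [ (λ p → let (a , eq , a<6 , bit) = to (Marked-tabulate 6 σ j x) p
             in a , eq , subst (a <_) (sym size) (≤-trans a<6 (m≤m+n 6 _)) , bit)
    , (λ p → let (a , eq , a<n , bit) = to (ChainVertices-tabulate os (λ a → σ (6 + a)) (6 + j) x) p
             in 6 + a , trans eq (sym (shift-6 a j)) , subst (6 + a <_) (sym size) (+-monoʳ-< 6 a<n) , bit) ]′
    (λ (a , eq , a<n , bit) → place a eq a<n bit (below-or-above-6 a))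
    where
      size : 6 * suc (suc (length os)) ≡ 6 + 6 * suc (length os)
      size = *-suc 6 (suc (length os))
      place : ∀ a → x ≡ a + j → a < 6 * suc (suc (length os)) → σ a ≡ true → (a < 6 ⊎ ∃ λ a′ → a ≡ 6 + a′) →
              ChainVertices j (o ∷ os) (toVertexMarks σ (o ∷ os)) x
      place a eq _ bit (inj₁ a<6) = inj₁ (from (Marked-tabulate 6 σ j x) (a , eq , a<6 , bit))
      place .(6 + a′) eq a<n bit (inj₂ (a′ , refl)) =
        inj₂ (from (ChainVertices-tabulate os (λ a → σ (6 + a)) (6 + j) x)
                   (a′ , trans eq (shift-6 a′ j) , +-cancelˡ-< 6 _ _ (subst (6 + a′ <_) size a<n) , bit))

  private
    bitAt-bound : ∀ {n} (S : Vec Bool n) a → bitAt S a ≡ true → a < n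
    bitAt-bound (b ∷ S) zero    _   = s≤s z≤n
    bitAt-bound (b ∷ S) (suc a) bit = s≤s (bitAt-bound S a bit)

  chain-vertices : ∀ os (S : Vec Bool (6 * suc (length os))) a →
                   (bitAt S a ≡ true) ⇔ ChainVertices 0 os (toVertexMarks (bitAt S) os) a
  chain-vertices os S a = mk⇔
    (λ bit → from (ChainVertices-tabulate os (bitAt S) 0 a) (a , sym (+-identityʳ a) , bitAt-bound S a bit , bit))
    (λ p → let (a′ , eq , _ , bit) = to (ChainVertices-tabulate os (bitAt S) 0 a) p
           in subst (λ z → bitAt S z ≡ true) (sym (trans eq (+-identityʳ a′))) bit)

  splitMarks : ∀ (E₁ E₂ : List (ℕ × ℕ)) → Vec Bool (length (E₁ ++ E₂)) → Vec Bool (length E₁) × Vec Bool (length E₂)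
  splitMarks []       E₂ F       = [] , F
  splitMarks (e ∷ E₁) E₂ (c ∷ F) = let (F₁ , F₂) = splitMarks E₁ E₂ F in c ∷ F₁ , F₂

  MarkedEdges-++ : ∀ E₁ E₂ F {u v} → MarkedEdges (E₁ ++ E₂) F u v ⇔
                   (MarkedEdges E₁ (proj₁ (splitMarks E₁ E₂ F)) u v ⊎ MarkedEdges E₂ (proj₂ (splitMarks E₁ E₂ F)) u v)
  MarkedEdges-++ []             E₂ F       = mk⇔ inj₂ [ (λ ()) , (λ e → e) ]′
  MarkedEdges-++ ((a , b) ∷ E₁) E₂ (c ∷ F) = mk⇔
    [ (λ e → inj₁ (inj₁ e)) , (λ e → [ (λ e₁ → inj₁ (inj₂ e₁)) , inj₂ ]′ (to (MarkedEdges-++ E₁ E₂ F) e)) ]′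
    [ [ inj₁ , (λ e₁ → inj₂ (from (MarkedEdges-++ E₁ E₂ F) (inj₁ e₁))) ]′ , (λ e₂ → inj₂ (from (MarkedEdges-++ E₁ E₂ F) (inj₂ e₂))) ]′

  Joins-cong : ∀ {a a′ b b′ u v} → a ≡ a′ → b ≡ b′ → Joins a b u v ⇔ Joins a′ b′ u v
  Joins-cong refl refl = ⇔-id _

  hexagon-edges : ∀ i f {u v} → MarkedEdges (hexEdges i) f u v ⇔ HexEdges (6 * i) f u v
  hexagon-edges i (b₀ ∷ b₁ ∷ b₂ ∷ b₃ ∷ b₄ ∷ b₅ ∷ []) =
    last-apart ⇔-∘ (relabel 0 1 ⊎-⇔ relabel 1 2 ⊎-⇔ relabel 2 3 ⊎-⇔ relabel 3 4 ⊎-⇔ relabel 4 5 ⊎-⇔ relabel 5 0 ⊎-⇔ ⇔-id ⊥)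
    where
      b = 6 * i
      relabel : ∀ k l {c u v} → (c ≡ true × Joins (b + k) (b + l) u v) ⇔ (c ≡ true × Joins (k + b) (l + b) u v)
      relabel k l = ⇔-id _ ×-⇔ Joins-cong (+-comm b k) (+-comm b l)
      last-apart : ∀ {A₀ A₁ A₂ A₃ A₄ A₅ : Set} →
                   (A₀ ⊎ A₁ ⊎ A₂ ⊎ A₃ ⊎ A₄ ⊎ A₅ ⊎ ⊥) ⇔ ((A₀ ⊎ A₁ ⊎ A₂ ⊎ A₃ ⊎ A₄ ⊎ ⊥) ⊎ A₅)
      last-apart = mk⇔
        [ (λ x → inj₁ (inj₁ x)) , [ (λ x → inj₁ (inj₂ (inj₁ x))) , [ (λ x → inj₁ (inj₂ (inj₂ (inj₁ x))))
        , [ (λ x → inj₁ (inj₂ (inj₂ (inj₂ (inj₁ x))))) , [ (λ x → inj₁ (inj₂ (inj₂ (inj₂ (inj₂ (inj₁ x))))))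
        , [ inj₂ , ⊥-elim ]′ ]′ ]′ ]′ ]′ ]′
        [ [ inj₁ , [ (λ x → inj₂ (inj₁ x)) , [ (λ x → inj₂ (inj₂ (inj₁ x))) , [ (λ x → inj₂ (inj₂ (inj₂ (inj₁ x))))
        , [ (λ x → inj₂ (inj₂ (inj₂ (inj₂ (inj₁ x))))) , ⊥-elim ]′ ]′ ]′ ]′ ]′
        , (λ x → inj₂ (inj₂ (inj₂ (inj₂ (inj₂ (inj₁ x)))))) ]′

  toEdgeMarks : ∀ i os → Vec Bool (length (hexagonEdgeList i (suc (length os)))) → Vec Bool (length (cutEdgeList i os)) →
                EdgeMarks os
  toEdgeMarks i []       FH FC       = proj₁ (splitMarks (hexEdges i) [] FH)
  toEdgeMarks i (o ∷ os) FH (c ∷ FC) =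
    let (f , FH′) = splitMarks (hexEdges i) (hexagonEdgeList (suc i) (suc (length os))) FH
    in f , c , toEdgeMarks (suc i) os FH′ FC

  chain-edges : ∀ os i FH FC {u v} →
    (MarkedEdges (hexagonEdgeList i (suc (length os))) FH u v ⊎ MarkedEdges (cutEdgeList i os) FC u v) ⇔
    ChainEdges (6 * i) os (toEdgeMarks i os FH FC) u v
  chain-edges [] i FH [] =
    hexagon-edges i _ ⇔-∘ (drop (no-edges _) ⇔-∘ (MarkedEdges-++ (hexEdges i) [] FH ⇔-∘ drop (λ ())))
    where
      drop : ∀ {A B : Set} → (B → ⊥) → (A ⊎ B) ⇔ A
      drop ¬b = mk⇔ [ (λ a → a) , (λ b → ⊥-elim (¬b b)) ]′ inj₁
      no-edges : ∀ (F : Vec Bool 0) {u v} → MarkedEdges [] F u v → ⊥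
      no-edges [] ()
  chain-edges (o ∷ os) i FH (c ∷ FC) {u} {v} =
    (hexagon-edges i _ ⊎-⇔ (⇔-id _ ×-⇔ Joins-cong (+-comm (6 * i) (toℕ o)) (*-suc 6 i)) ⊎-⇔ rest)
    ⇔-∘ (regroup ⇔-∘ (MarkedEdges-++ (hexEdges i) (hexagonEdgeList (suc i) (suc (length os))) FH ⊎-⇔ ⇔-id _))
    where
      FH′ = proj₂ (splitMarks (hexEdges i) (hexagonEdgeList (suc i) (suc (length os))) FH)
      Later : Set
      Later = MarkedEdges (hexagonEdgeList (suc i) (suc (length os))) FH′ u v ⊎ MarkedEdges (cutEdgeList (suc i) os) FC u v
      rest : Later ⇔ ChainEdges (6 + 6 * i) os (toEdgeMarks (suc i) os FH′ FC) u v
      rest = subst (λ j → Later ⇔ ChainEdges j os (toEdgeMarks (suc i) os FH′ FC) u v) (*-suc 6 i) (chain-edges os (suc i) FH′ FC)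
      regroup : ∀ {A B C D : Set} → ((A ⊎ B) ⊎ (C ⊎ D)) ⇔ (A ⊎ C ⊎ B ⊎ D)
      regroup = mk⇔ [ [ inj₁ , (λ b → inj₂ (inj₂ (inj₁ b))) ]′ , [ (λ c → inj₂ (inj₁ c)) , (λ d → inj₂ (inj₂ (inj₂ d))) ]′ ]′
                    [ (λ a → inj₁ (inj₁ a)) , [ (λ c → inj₂ (inj₁ c)) , [ (λ b → inj₁ (inj₂ b)) , (λ d → inj₂ (inj₂ d)) ]′ ]′ ]′

open ChainGraphs

module ChainCounts where

  open import Data.Nat using (ℕ; zero; suc; _+_; _*_)
  open import Data.Nat.Properties using (+-identityʳ; +-suc; *-suc)
  open import Data.Fin using (Fin; zero; suc; toℕ)
  open import Data.Fin.Properties using (+↔⊎)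
  open import Data.Fin.Permutation using (↔⇒≡)
  open import Data.Bool using (Bool; true; false)
  import Data.Bool.Properties
  open import Axiom.UniquenessOfIdentityProofs using (module Decidable⇒UIP)
  open import Data.Vec using (Vec; []; _∷_; _++_; tabulate; toList)
  open import Data.Vec.Properties using (length-toList)
  open import Data.List using (List; []; _∷_; length; map; concatMap; applyUpTo; cartesianProduct) renaming (_++_ to _++ₗ_)
  open import Data.List.Properties using (length-map)
  open import Data.Product using (Σ; _×_; _,_; proj₁; proj₂)
  open import Data.Product.Algebra using (Σ-assoc)
  open import Data.Product.Function.Dependent.Propositional using (Σ-↔)
  open import Data.Sum using (_⊎_; inj₁; inj₂)
  open import Data.Sum.Function.Propositional using (_⊎-↔_)
  open import Function.Base using (_∘_)
  open import Function.Bundles using (_↔_; mk↔ₛ′)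
  open import Function.Construct.Composition using (_↔-∘_)
  open import Function.Construct.Symmetry using (↔-sym; ⇔-sym)
  open import Function.Construct.Identity using (↔-id)
  open import Function.Construct.Composition using (_⇔-∘_)
  open import Relation.Nullary using (Dec; does)
  open import Relation.Nullary.Decidable using (dec-true; recompute) renaming (map to map-Dec)
  open import Relation.Binary.PropositionalEquality using (_≡_; refl; sym; trans; subst; cong; cong₂)
  open import Relation.Binary.PropositionalEquality.Properties using (module ≡-Reasoning)

  open import Defs

  open ≡-Reasoning

  ≡true↔Fin : ∀ b → (b ≡ true) ↔ Fin (fromBool b)
  ≡true↔Fin true  = mk↔ₛ′ (λ _ → zero) (λ _ → refl) (λ { zero → refl }) (λ { refl → refl })
  ≡true↔Fin false = mk↔ₛ′ (λ ()) (λ ()) (λ ()) (λ ())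

  Fin-cong : ∀ {m n} → m ≡ n → Fin m ↔ Fin n
  Fin-cong refl = ↔-id _

  Σ-booleanVectors-suc : ∀ n (B : Vec Bool (suc n) → Set) →
                         Σ (Vec Bool (suc n)) B ↔ (Σ (Vec Bool n) (B ∘ (true ∷_)) ⊎ Σ (Vec Bool n) (B ∘ (false ∷_)))
  Σ-booleanVectors-suc n B = mk↔ₛ′ split join split∘join join∘split
    where
      split : Σ (Vec Bool (suc n)) B → _
      split (true  ∷ v , b) = inj₁ (v , b)
      split (false ∷ v , b) = inj₂ (v , b)
      join : _ → Σ (Vec Bool (suc n)) B
      join (inj₁ (v , b)) = true ∷ v , b
      join (inj₂ (v , b)) = false ∷ v , b
      split∘join : ∀ y → split (join y) ≡ y
      split∘join (inj₁ _) = refl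
      split∘join (inj₂ _) = refl
      join∘split : ∀ x → join (split x) ≡ x
      join∘split (true  ∷ v , b) = refl
      join∘split (false ∷ v , b) = refl

  Σ-Fin : ∀ n (h : Vec Bool n → ℕ) → Σ (Vec Bool n) (Fin ∘ h) ↔ Fin (∑ (booleanVectors n) h)
  Σ-Fin zero    h = Fin-cong (sym (∑-booleanVectors-zero h)) ↔-∘ mk↔ₛ′ (λ { ([] , i) → i }) ([] ,_) (λ _ → refl) (λ { ([] , i) → refl })
  Σ-Fin (suc n) h =
    Fin-cong (sym (∑-booleanVectors-suc n h))
    ↔-∘ (↔-sym +↔⊎ ↔-∘ ((Σ-Fin n (h ∘ (true ∷_)) ⊎-↔ Σ-Fin n (h ∘ (false ∷_))) ↔-∘ Σ-booleanVectors-suc n (Fin ∘ h)))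

  Σ-≡true↔Fin : ∀ m n (d : Vec Bool m → Vec Bool n → Bool) →
               Σ (Vec Bool m × Vec Bool n) (λ (S , F) → d S F ≡ true) ↔ Fin (∑[ S ← booleanVectors m ] ∑[ F ← booleanVectors n ] fromBool (d S F))
  Σ-≡true↔Fin m n d =
    Σ-Fin m _ ↔-∘ (Σ-↔ (↔-id _) (Σ-Fin n _ ↔-∘ Σ-↔ (↔-id _) (≡true↔Fin _)) ↔-∘ Σ-assoc)

  ∑-splitMarks : ∀ E₁ E₂ (g : Vec Bool (length E₁) → Vec Bool (length E₂) → ℕ) →
    ∑[ F ← booleanVectors (length (E₁ ++ₗ E₂)) ] g (proj₁ (splitMarks E₁ E₂ F)) (proj₂ (splitMarks E₁ E₂ F))
    ≡ ∑[ F₁ ← booleanVectors (length E₁) ] ∑[ F₂ ← booleanVectors (length E₂) ] g F₁ F₂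
  ∑-splitMarks []       E₂ g = sym (∑-booleanVectors-zero (λ F₁ → ∑[ F₂ ← booleanVectors (length E₂) ] g F₁ F₂))
  ∑-splitMarks (e ∷ E₁) E₂ g =
    trans (∑-booleanVectors-suc (length (E₁ ++ₗ E₂)) _)
          (trans (cong₂ _+_ (∑-splitMarks E₁ E₂ (g ∘ (true ∷_))) (∑-splitMarks E₁ E₂ (g ∘ (false ∷_))))
                 (sym (∑-booleanVectors-suc (length E₁) (λ F₁ → ∑[ F₂ ← booleanVectors (length E₂) ] g F₁ F₂))))

  ∑-toVertexMarks : ∀ os (h : VertexMarks os → ℕ) →
    ∑[ S ← booleanVectors (6 * suc (length os)) ] h (toVertexMarks (bitAt S) os) ≡ ∑ (vertexMarkings os) h
  ∑-toVertexMarks [] h =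
    trans (∑-cong (booleanVectors 6) (λ S → cong h (tabulate-bitAt S))) (cong (λ L → ∑ L h) (sym hexagonMarks≡))
    where
      tabulate-bitAt : ∀ (S : Vec Bool 6) → tabulate (bitAt S ∘ toℕ) ≡ S
      tabulate-bitAt (_ ∷ _ ∷ _ ∷ _ ∷ _ ∷ _ ∷ []) = refl
  ∑-toVertexMarks (o ∷ os) h = begin
    Q (6 * suc (suc (length os)))
      ≡⟨ cong Q (*-suc 6 (suc (length os))) ⟩
    Q (6 + 6 * suc (length os))
      ≡⟨ ∑-booleanVectors-++ 6 (6 * suc (length os)) _ ⟩
    ∑[ s ← booleanVectors 6 ] ∑[ S ← booleanVectors (6 * suc (length os)) ] h (toVertexMarks (bitAt (s ++ S)) (o ∷ os))
      ≡⟨ ∑-cong (booleanVectors 6) (λ s → trans (∑-cong (booleanVectors (6 * suc (length os))) (λ S → cong h (first-hexagon s S)))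
                                                (∑-toVertexMarks os (λ ss → h (s , ss)))) ⟩
    ∑[ s ← booleanVectors 6 ] ∑[ ss ← vertexMarkings os ] h (s , ss)
      ≡⟨ cong (λ L → ∑[ s ← L ] ∑[ ss ← vertexMarkings os ] h (s , ss)) (sym hexagonMarks≡) ⟩
    ∑[ s ← hexagonMarks ] ∑[ ss ← vertexMarkings os ] h (s , ss)
      ≡⟨ sym (∑-cartesianProduct hexagonMarks (vertexMarkings os) h) ⟩
    ∑ (vertexMarkings (o ∷ os)) h ∎
    where
      Q : ℕ → ℕ
      Q n = ∑[ S ← booleanVectors n ] h (toVertexMarks (bitAt S) (o ∷ os))
      first-hexagon : ∀ (s : Vec Bool 6) {m} (S : Vec Bool m) → toVertexMarks (bitAt (s ++ S)) (o ∷ os) ≡ (s , toVertexMarks (bitAt S) os)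
      first-hexagon (_ ∷ _ ∷ _ ∷ _ ∷ _ ∷ _ ∷ []) S = refl

  ∑-toEdgeMarks : ∀ i os (h : EdgeMarks os → ℕ) →
    ∑[ FH ← booleanVectors (length (hexagonEdgeList i (suc (length os)))) ] ∑[ FC ← booleanVectors (length (cutEdgeList i os)) ]
      h (toEdgeMarks i os FH FC)
    ≡ ∑ (edgeMarkings os) h
  ∑-toEdgeMarks i [] h = begin
    ∑[ FH ← booleanVectors (length (hexEdges i ++ₗ [])) ] ∑[ FC ← booleanVectors 0 ] h (proj₁ (splitMarks (hexEdges i) [] FH))
      ≡⟨ ∑-cong (booleanVectors _) (λ FH → ∑-booleanVectors-zero _) ⟩
    ∑[ FH ← booleanVectors (length (hexEdges i ++ₗ [])) ] h (proj₁ (splitMarks (hexEdges i) [] FH))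
      ≡⟨ ∑-splitMarks (hexEdges i) [] (λ f _ → h f) ⟩
    ∑[ f ← booleanVectors 6 ] ∑[ _ ← booleanVectors 0 ] h f
      ≡⟨ ∑-cong (booleanVectors 6) (λ f → ∑-booleanVectors-zero _) ⟩
    ∑ (booleanVectors 6) h
      ≡⟨ cong (λ L → ∑ L h) (sym hexagonMarks≡) ⟩
    ∑ hexagonMarks h ∎
  ∑-toEdgeMarks i (o ∷ os) h = begin
    ∑[ FH ← booleanVectors (length (hexEdges i ++ₗ Later)) ] ∑[ FC ← booleanVectors (suc n) ] h (toEdgeMarks i (o ∷ os) FH FC)
      ≡⟨ ∑-cong (booleanVectors _) (λ FH → trans (∑-booleanVectors-suc n (λ FC → h (toEdgeMarks i (o ∷ os) FH FC)))
                                                  (cong (∑[ FC ← booleanVectors n ] h (toEdgeMarks i (o ∷ os) FH (true ∷ FC)) +_)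
                                                        (sym (+-identityʳ _)))) ⟩
    ∑[ FH ← booleanVectors (length (hexEdges i ++ₗ Later)) ] g (proj₁ (splitMarks (hexEdges i) Later FH)) (proj₂ (splitMarks (hexEdges i) Later FH))
      ≡⟨ ∑-splitMarks (hexEdges i) Later g ⟩
    ∑[ f ← booleanVectors 6 ] ∑[ FH′ ← booleanVectors (length Later) ] g f FH′
      ≡⟨ ∑-cong (booleanVectors 6) (λ f → ∑-comm (booleanVectors (length Later)) (true ∷ false ∷ [])
                                                  (λ FH′ c → ∑[ FC ← booleanVectors n ] h (f , c , toEdgeMarks (suc i) os FH′ FC))) ⟩
    ∑[ f ← booleanVectors 6 ] ∑[ c ← true ∷ false ∷ [] ] ∑[ FH′ ← booleanVectors (length Later) ] ∑[ FC ← booleanVectors n ]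
      h (f , c , toEdgeMarks (suc i) os FH′ FC)
      ≡⟨ ∑-cong (booleanVectors 6) (λ f → ∑-cong (true ∷ false ∷ []) (λ c → ∑-toEdgeMarks (suc i) os (λ fs → h (f , c , fs)))) ⟩
    ∑[ f ← booleanVectors 6 ] ∑[ c ← true ∷ false ∷ [] ] ∑[ fs ← edgeMarkings os ] h (f , c , fs)
      ≡⟨ cong (λ L → ∑[ f ← L ] ∑[ c ← true ∷ false ∷ [] ] ∑[ fs ← edgeMarkings os ] h (f , c , fs)) (sym hexagonMarks≡) ⟩
    ∑[ f ← hexagonMarks ] ∑[ c ← true ∷ false ∷ [] ] ∑[ fs ← edgeMarkings os ] h (f , c , fs)
      ≡⟨ sym (∑-cong hexagonMarks (λ f → ∑-cartesianProduct (true ∷ false ∷ []) (edgeMarkings os) (λ p → h (f , p)))) ⟩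
    ∑[ f ← hexagonMarks ] ∑ (cartesianProduct (true ∷ false ∷ []) (edgeMarkings os)) (λ p → h (f , p))
      ≡⟨ sym (∑-cartesianProduct hexagonMarks _ h) ⟩
    ∑ (edgeMarkings (o ∷ os)) h ∎
    where
      Later = hexagonEdgeList (suc i) (suc (length os))
      n = length (cutEdgeList (suc i) os)
      g : Vec Bool 6 → Vec Bool (length Later) → ℕ
      g f FH′ = ∑[ c ← true ∷ false ∷ [] ] ∑[ FC ← booleanVectors n ] h (f , c , toEdgeMarks (suc i) os FH′ FC)

  module _ (os : Exits) where

    private
      Hexes = hexagonEdgeList 0 (suc (length os))
      Cuts  = cutEdgeList 0 os
      G     = chainGraph os

      edgeMarks : Vec Bool (length (E G)) → EdgeMarks os
      edgeMarks F = toEdgeMarks 0 os (proj₁ (splitMarks Hexes Cuts F)) (proj₂ (splitMarks Hexes Cuts F))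

    chainGraph-isTree? : ∀ S F → Dec (IsTree G S F)
    chainGraph-isTree? S F =
      map-Dec (⇔-sym (IsTreeOn-cong (chain-vertices os S _) (chain-edges os 0 _ _ ⇔-∘ MarkedEdges-++ Hexes Cuts F) ⇔-∘ IsTree⇔IsTreeOn G S F))
          (chain? 0 os (toVertexMarks (bitAt S) os) (edgeMarks F))

    private
      Subtree↔ : Subtree G ↔ Σ (Vec Bool (V G) × Vec Bool (length (E G))) (λ (S , F) → does (chainGraph-isTree? S F) ≡ true)
      Subtree↔ = mk↔ₛ′ (λ (subtree S F t) → (S , F) , dec-true (chainGraph-isTree? S F) (recompute (chainGraph-isTree? S F) t))
                       (λ ((S , F) , accepted) → subtree S F (true-yields (chainGraph-isTree? S F) accepted))
                       (λ ((S , F) , _) → cong ((S , F) ,_) (Decidable⇒UIP.≡-irrelevant Data.Bool.Properties._≟_ _ _))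
                       (λ _ → refl)

      count-markings : ∑[ S ← booleanVectors (V G) ] ∑[ F ← booleanVectors (length (E G)) ] ⟦ chainGraph-isTree? S F ⟧
                       ≡ treeCount 0 os
      count-markings =
        trans (∑-cong (booleanVectors (V G)) (λ S →
                 trans (∑-splitMarks Hexes Cuts (λ FH FC → ⟦ chain? 0 os (toVertexMarks (bitAt S) os) (toEdgeMarks 0 os FH FC) ⟧))
                       (∑-toEdgeMarks 0 os (λ fs → ⟦ chain? 0 os (toVertexMarks (bitAt S) os) fs ⟧))))
              (∑-toVertexMarks os (λ ss → ∑[ fs ← edgeMarkings os ] ⟦ chain? 0 os ss fs ⟧))

    chainGraph-stn : ∀ k → HasSTN G k → k ≡ stn os
    chainGraph-stn k Fin↔ = trans (↔⇒≡ (Σ-≡true↔Fin (V G) (length (E G)) _ ↔-∘ (Subtree↔ ↔-∘ Fin↔)))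
                                  (trans count-markings (proj₁ (counts 0 os)))

  toExit : Dist → Fin 6
  toExit ortho = suc zero
  toExit meta  = suc (suc zero)
  toExit para  = suc (suc (suc zero))

  exits : ∀ {k} → Vec Dist k → Exits
  exits ds = map toExit (toList ds)

  chain≡chainGraph : ∀ {m} (ds : Vec Dist m) → chain (suc (suc m)) ds ≡ chainGraph (zero ∷ exits ds)
  chain≡chainGraph {m} ds = cong₂ (λ v e → record { V = v ; E = e })
    (cong (λ k → 6 * suc (suc k)) (sym size))
    (cong₂ _++ₗ_ (trans (hexagons (suc (suc m)) 0 (λ x → x) (λ _ → refl)) (cong (λ k → hexagonEdgeList 0 (suc (suc k))) (sym size)))
                 (cong (λ L → cutEdges 0 (0 ∷ L)) (sym (exit-offsets (toList ds)))))
    where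
      size : length (exits ds) ≡ m
      size = trans (length-map toExit (toList ds)) (length-toList ds)
      hexagons : ∀ m i (f : ℕ → ℕ) → (∀ x → f x ≡ i + x) → concatMap hexEdges (applyUpTo f m) ≡ hexagonEdgeList i m
      hexagons zero    i f f≗ = refl
      hexagons (suc m) i f f≗ = cong₂ _++ₗ_ (cong hexEdges (trans (f≗ 0) (+-identityʳ i)))
                                            (hexagons m (suc i) (f ∘ suc) (λ x → trans (f≗ (suc x)) (+-suc i x)))
      exit-offsets : ∀ (L : List Dist) → map toℕ (map toExit L) ≡ map distℕ L
      exit-offsets []           = refl
      exit-offsets (ortho ∷ L) = cong (1 ∷_) (exit-offsets L)
      exit-offsets (meta  ∷ L) = cong (2 ∷_) (exit-offsets L)
      exit-offsets (para  ∷ L) = cong (3 ∷_) (exit-offsets L)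

  chain-stn : ∀ {m} (ds : Vec Dist m) k → HasSTN (chain (suc (suc m)) ds) k → k ≡ stn (zero ∷ exits ds)
  chain-stn ds k Fin↔ = chainGraph-stn (zero ∷ exits ds) k (subst (λ G → Fin k ↔ Subtree G) (chain≡chainGraph ds) Fin↔)

open ChainCounts

module Expectation where

  open import Data.Nat as ℕ using (ℕ; zero; suc)
  open import Data.Integer as ℤ using (+_)
  import Data.Integer.Properties as ℤ
  open import Data.Rational using (ℚ; mkℚ; _+_; _*_; _-_; _÷_; 1/_; 0ℚ; 1ℚ; NonZero)
  open import Data.Rational.Properties using (↥p/↧p≡p; /-cong; *-inverseˡ; *-identityˡ; *-identityʳ; +-identityˡ)
  open import Data.Rational.Solver using (module +-*-Solver)
  import Data.Nat.Coprimality as Coprimality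
  open import Data.Vec using (Vec; []; _∷_)
  open import Data.List using ([]; _∷_)
  open import Function.Base using (_∘_)
  open import Relation.Binary.PropositionalEquality using (_≡_; refl; sym; trans; cong; cong₂)
  open import Relation.Binary.PropositionalEquality.Properties using (module ≡-Reasoning)

  open import Defs

  -- ℕ literals are resolved by instance search here, too late for the arity argument of solve
  -- to unfold its type; the reflexivity proofs passed to solve are therefore implicit lambdas.
  open +-*-Solver using (solve; _:+_; _:*_; _:-_; _:=_; con; Polynomial)
  open ≡-Reasoning

  private
    ℕtoℚ≡mkℚ : ∀ n → ℕtoℚ n ≡ mkℚ (+ n) 0 (Coprimality.sym (Coprimality.1-coprimeTo n))
    ℕtoℚ≡mkℚ n = ↥p/↧p≡p (mkℚ (+ n) 0 (Coprimality.sym (Coprimality.1-coprimeTo n)))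

  ℕtoℚ-+ : ∀ m n → ℕtoℚ (m ℕ.+ n) ≡ ℕtoℚ m + ℕtoℚ n
  ℕtoℚ-+ m n = trans (/-cong {+ (m ℕ.+ n)} {1} {+ m ℤ.* + 1 ℤ.+ + n ℤ.* + 1} {1}
                             (trans (ℤ.pos-+ m n) (sym (cong₂ ℤ._+_ (ℤ.*-identityʳ (+ m)) (ℤ.*-identityʳ (+ n))))) refl)
                     (sym (cong₂ _+_ (ℕtoℚ≡mkℚ m) (ℕtoℚ≡mkℚ n)))

  ℕtoℚ-* : ∀ m n → ℕtoℚ (m ℕ.* n) ≡ ℕtoℚ m * ℕtoℚ n
  ℕtoℚ-* m n = trans (/-cong {+ (m ℕ.* n)} {1} {+ m ℤ.* + n} {1} (ℤ.pos-* m n) refl)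
                     (sym (cong₂ _*_ (ℕtoℚ≡mkℚ m) (ℕtoℚ≡mkℚ n)))

  module _ (p₁ p₂ : ℚ) where

    private
      q : ℚ
      q = 1ℚ - p₁ - p₂

    expect-cong : ∀ k {f g : Vec Dist k → ℚ} → (∀ ds → f ds ≡ g ds) → expect p₁ p₂ k f ≡ expect p₁ p₂ k g
    expect-cong zero    f≗g = f≗g []
    expect-cong (suc k) f≗g =
      cong₂ _+_ (cong₂ _+_ (cong (p₁ *_) (expect-cong k (f≗g ∘ (ortho ∷_))))
                           (cong (p₂ *_) (expect-cong k (f≗g ∘ (meta ∷_)))))
                (cong (q *_) (expect-cong k (f≗g ∘ (para ∷_))))

    expect-affine : ∀ k a b (f : Vec Dist k → ℚ) → expect p₁ p₂ k (λ ds → a + b * f ds) ≡ a + b * expect p₁ p₂ k f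
    expect-affine zero    a b f = refl
    expect-affine (suc k) a b f =
      trans (cong₂ _+_ (cong₂ _+_ (cong (p₁ *_) (step ortho)) (cong (p₂ *_) (step meta))) (cong (q *_) (step para)))
            (solve 7 (λ p₁ p₂ a b e₁ e₂ e₃ →
                        p₁ :* (a :+ b :* e₁) :+ p₂ :* (a :+ b :* e₂) :+ (con 1ℚ :- p₁ :- p₂) :* (a :+ b :* e₃)
                        := a :+ b :* (p₁ :* e₁ :+ p₂ :* e₂ :+ (con 1ℚ :- p₁ :- p₂) :* e₃))
                   (λ {_ _ _ _ _ _ _} → refl) p₁ p₂ a b (Eᵈ ortho) (Eᵈ meta) (Eᵈ para))
      where
        Eᵈ : Dist → ℚ
        Eᵈ d = expect p₁ p₂ k (f ∘ (d ∷_))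
        step : ∀ d → expect p₁ p₂ k (λ ds → a + b * f (d ∷ ds)) ≡ a + b * Eᵈ d
        step d = expect-affine k a b (f ∘ (d ∷_))

    expect-+ : ∀ k (f g : Vec Dist k → ℚ) → expect p₁ p₂ k (λ ds → f ds + g ds) ≡ expect p₁ p₂ k f + expect p₁ p₂ k g
    expect-+ zero    f g = refl
    expect-+ (suc k) f g =
      trans (cong₂ _+_ (cong₂ _+_ (cong (p₁ *_) (step ortho)) (cong (p₂ *_) (step meta))) (cong (q *_) (step para)))
            (solve 8 (λ p₁ p₂ e₁ e₂ e₃ e₁′ e₂′ e₃′ →
                        p₁ :* (e₁ :+ e₁′) :+ p₂ :* (e₂ :+ e₂′) :+ (con 1ℚ :- p₁ :- p₂) :* (e₃ :+ e₃′)
                        := (p₁ :* e₁ :+ p₂ :* e₂ :+ (con 1ℚ :- p₁ :- p₂) :* e₃)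
                           :+ (p₁ :* e₁′ :+ p₂ :* e₂′ :+ (con 1ℚ :- p₁ :- p₂) :* e₃′))
                   (λ {_ _ _ _ _ _ _ _} → refl) p₁ p₂ (Eᵈ f ortho) (Eᵈ f meta) (Eᵈ f para) (Eᵈ g ortho) (Eᵈ g meta) (Eᵈ g para))
      where
        Eᵈ : (Vec Dist (suc k) → ℚ) → Dist → ℚ
        Eᵈ h d = expect p₁ p₂ k (h ∘ (d ∷_))
        step : ∀ d → expect p₁ p₂ k (λ ds → f (d ∷ ds) + g (d ∷ ds)) ≡ Eᵈ f d + Eᵈ g d
        step d = expect-+ k (f ∘ (d ∷_)) (g ∘ (d ∷_))

    -- stn and stn₀ averaged over chains of k + 1 hexagons whose k exits are all random
    Eₛ E₀ : ℕ → ℚ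
    Eₛ k = expect p₁ p₂ k (ℕtoℚ ∘ stn ∘ exits)
    E₀ k = expect p₁ p₂ k (ℕtoℚ ∘ stn₀ ∘ exits)

    -- the first exit does not matter for stn
    stn-step : ∀ k o → expect p₁ p₂ k (λ ds → ℕtoℚ (stn (o ∷ exits ds))) ≡ 36 + Eₛ k + 21 * E₀ k
    stn-step k o = begin
      expect p₁ p₂ k (λ ds → ℕtoℚ (stn (o ∷ exits ds)))
        ≡⟨ expect-cong k (λ ds → trans (ℕtoℚ-+ (36 ℕ.+ stn (exits ds)) (21 ℕ.* stn₀ (exits ds)))
                                       (cong₂ _+_ (ℕtoℚ-+ 36 (stn (exits ds))) (ℕtoℚ-* 21 (stn₀ (exits ds))))) ⟩
      expect p₁ p₂ k (λ ds → 36 + ℕtoℚ (stn (exits ds)) + 21 * ℕtoℚ (stn₀ (exits ds)))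
        ≡⟨ expect-+ k _ _ ⟩
      expect p₁ p₂ k (λ ds → 36 + ℕtoℚ (stn (exits ds))) + expect p₁ p₂ k (λ ds → 21 * ℕtoℚ (stn₀ (exits ds)))
        ≡⟨ cong₂ _+_ (trans (expect-cong k (λ ds → cong (λ x → 36 + x) (sym (*-identityˡ (ℕtoℚ (stn (exits ds))))))) (expect-affine k 36 1ℚ (ℕtoℚ ∘ stn ∘ exits)))
                     (trans (expect-cong k (λ ds → sym (+-identityˡ (21 * ℕtoℚ (stn₀ (exits ds)))))) (expect-affine k 0ℚ 21 (ℕtoℚ ∘ stn₀ ∘ exits))) ⟩
      36 + 1ℚ * Eₛ k + (0ℚ + 21 * E₀ k)
        ≡⟨ cong₂ (λ x y → 36 + x + y) (*-identityˡ (Eₛ k)) (+-identityˡ _) ⟩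
      36 + Eₛ k + 21 * E₀ k ∎

    Eₛ-suc : ∀ k → Eₛ (suc k) ≡ 36 + Eₛ k + 21 * E₀ k
    Eₛ-suc k =
      trans (cong₂ _+_ (cong₂ _+_ (cong (p₁ *_) (stn-step k (toExit ortho))) (cong (p₂ *_) (stn-step k (toExit meta))))
                       (cong (q *_) (stn-step k (toExit para))))
            (solve 4 (λ p₁ p₂ e e₀ → p₁ :* next e e₀ :+ p₂ :* next e e₀ :+ (con 1ℚ :- p₁ :- p₂) :* next e e₀ := next e e₀)
                   (λ {_ _ _ _} → refl) p₁ p₂ (Eₛ k) (E₀ k))
      where
        next = λ e e₀ → con 36 :+ e :+ con 21 :* e₀

    E₀-suc : ∀ k → E₀ (suc k) ≡ p₁ * (21 + 16 * E₀ k) + p₂ * (21 + 13 * E₀ k) + q * (21 + 12 * E₀ k)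
    E₀-suc k = cong₂ _+_ (cong₂ _+_ (cong (p₁ *_) (step ortho)) (cong (p₂ *_) (step meta))) (cong (q *_) (step para))
      where
        step : ∀ d → expect p₁ p₂ k (λ ds → ℕtoℚ (stn₀ (toExit d ∷ exits ds))) ≡ 21 + ℕtoℚ (throughBoth (toExit d)) * E₀ k
        step d = trans (expect-cong k (λ ds → trans (ℕtoℚ-+ 21 (throughBoth (toExit d) ℕ.* stn₀ (exits ds)))
                                                    (cong (λ x → 21 + x) (ℕtoℚ-* (throughBoth (toExit d)) (stn₀ (exits ds))))))
                       (expect-affine k 21 (ℕtoℚ (throughBoth (toExit d))) (ℕtoℚ ∘ stn₀ ∘ exits))

    private
      Dₑ Rₑ Xₑ : ∀ {n} → Polynomial n → Polynomial n → Polynomial n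
      Dₑ p₁ p₂ = con 11 :+ con 4 :* p₁ :+ p₂
      Rₑ p₁ p₂ = con 12 :+ con 4 :* p₁ :+ p₂
      Xₑ p₁ p₂ = con 144 :* p₁ :+ con 36 :* p₂ :- con 45

      D r X : ℚ
      D = 11 + 4 * p₁ + p₂
      r = 12 + 4 * p₁ + p₂
      X = 144 * p₁ + 36 * p₂ - 45

    D*E₀ : ∀ k → D * E₀ k ≡ 21 * (r ^ℚ suc k - 1ℚ)
    D*E₀ zero = solve 2 (λ p₁ p₂ → Dₑ p₁ p₂ :* con 21 := con 21 :* (Rₑ p₁ p₂ :* con 1ℚ :- con 1ℚ))
                      (λ {_ _} → refl) p₁ p₂
    D*E₀ (suc k) = begin
      D * E₀ (suc k)
        ≡⟨ cong (D *_) (E₀-suc k) ⟩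
      D * (p₁ * (21 + 16 * E₀ k) + p₂ * (21 + 13 * E₀ k) + q * (21 + 12 * E₀ k))
        ≡⟨ solve 3 (λ p₁ p₂ e₀ → Dₑ p₁ p₂ :* (p₁ :* (con 21 :+ con 16 :* e₀) :+ p₂ :* (con 21 :+ con 13 :* e₀)
                                   :+ (con 1ℚ :- p₁ :- p₂) :* (con 21 :+ con 12 :* e₀))
                                 := con 21 :* Dₑ p₁ p₂ :+ Rₑ p₁ p₂ :* (Dₑ p₁ p₂ :* e₀))
                 (λ {_ _ _} → refl) p₁ p₂ (E₀ k) ⟩
      21 * D + r * (D * E₀ k)
        ≡⟨ cong (λ z → 21 * D + r * z) (D*E₀ k) ⟩
      21 * D + r * (21 * (r ^ℚ suc k - 1ℚ))
        ≡⟨ solve 3 (λ p₁ p₂ R → con 21 :* Dₑ p₁ p₂ :+ Rₑ p₁ p₂ :* (con 21 :* (R :- con 1ℚ))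
                                := con 21 :* (Rₑ p₁ p₂ :* R :- con 1ℚ))
                 (λ {_ _ _} → refl) p₁ p₂ (r ^ℚ suc k) ⟩
      21 * (r ^ℚ suc (suc k) - 1ℚ) ∎

    D²*Eₛ : ∀ k → D * D * Eₛ k ≡ 441 * r ^ℚ suc k + X * D * ℕtoℚ (suc k) - 441
    D²*Eₛ zero = solve 2 (λ p₁ p₂ → Dₑ p₁ p₂ :* Dₑ p₁ p₂ :* con 36
                                    := con 441 :* (Rₑ p₁ p₂ :* con 1ℚ) :+ Xₑ p₁ p₂ :* Dₑ p₁ p₂ :* con 1ℚ :- con 441)
                       (λ {_ _} → refl) p₁ p₂
    D²*Eₛ (suc k) = begin
      D * D * Eₛ (suc k)
        ≡⟨ cong (D * D *_) (Eₛ-suc k) ⟩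
      D * D * (36 + Eₛ k + 21 * E₀ k)
        ≡⟨ solve 4 (λ p₁ p₂ e e₀ → Dₑ p₁ p₂ :* Dₑ p₁ p₂ :* (con 36 :+ e :+ con 21 :* e₀)
                                   := con 36 :* (Dₑ p₁ p₂ :* Dₑ p₁ p₂) :+ Dₑ p₁ p₂ :* Dₑ p₁ p₂ :* e :+ con 21 :* Dₑ p₁ p₂ :* (Dₑ p₁ p₂ :* e₀))
                 (λ {_ _ _ _} → refl) p₁ p₂ (Eₛ k) (E₀ k) ⟩
      36 * (D * D) + D * D * Eₛ k + 21 * D * (D * E₀ k)
        ≡⟨ cong₂ (λ x y → 36 * (D * D) + x + 21 * D * y) (D²*Eₛ k) (D*E₀ k) ⟩
      36 * (D * D) + (441 * r ^ℚ suc k + X * D * ℕtoℚ (suc k) - 441) + 21 * D * (21 * (r ^ℚ suc k - 1ℚ))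
        ≡⟨ solve 4 (λ p₁ p₂ R N → con 36 :* (Dₑ p₁ p₂ :* Dₑ p₁ p₂) :+ (con 441 :* R :+ Xₑ p₁ p₂ :* Dₑ p₁ p₂ :* N :- con 441)
                                    :+ con 21 :* Dₑ p₁ p₂ :* (con 21 :* (R :- con 1ℚ))
                                  := con 441 :* (Rₑ p₁ p₂ :* R) :+ Xₑ p₁ p₂ :* Dₑ p₁ p₂ :* (con 1ℚ :+ N) :- con 441)
                 (λ {_ _ _ _} → refl) p₁ p₂ (r ^ℚ suc k) (ℕtoℚ (suc k)) ⟩
      441 * (r * r ^ℚ suc k) + X * D * (1ℚ + ℕtoℚ (suc k)) - 441
        ≡⟨ cong (λ z → 441 * r ^ℚ suc (suc k) + X * D * z - 441) (sym (ℕtoℚ-+ 1 (suc k))) ⟩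
      441 * r ^ℚ suc (suc k) + X * D * ℕtoℚ (suc (suc k)) - 441 ∎

    divide : ∀ .{{_ : NonZero D}} .{{_ : NonZero (D * D)}} Y N R → D * D * Y ≡ 441 * R + X * D * N - 441 →
             Y ≡ 441 ÷ (D * D) * R + X ÷ D * N - 441 ÷ (D * D)
    divide Y N R D²Y = begin
      Y                                ≡⟨ sym (*-identityˡ Y) ⟩
      1ℚ * Y                           ≡⟨ cong (_* Y) (sym (*-inverseˡ (D * D))) ⟩
      1/ (D * D) * (D * D) * Y         ≡⟨ solve 4 (λ p₁ p₂ u y → u :* (Dₑ p₁ p₂ :* Dₑ p₁ p₂) :* y := u :* (Dₑ p₁ p₂ :* Dₑ p₁ p₂ :* y))
                                                 (λ {_ _ _ _} → refl) p₁ p₂ (1/ (D * D)) Y ⟩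
      1/ (D * D) * (D * D * Y)         ≡⟨ cong (1/ (D * D) *_) D²Y ⟩
      1/ (D * D) * (441 * R + X * D * N - 441)
        ≡⟨ solve 5 (λ p₁ p₂ u R N → u :* (con 441 :* R :+ Xₑ p₁ p₂ :* Dₑ p₁ p₂ :* N :- con 441)
                                    := con 441 :* u :* R :+ Xₑ p₁ p₂ :* (Dₑ p₁ p₂ :* u) :* N :- con 441 :* u)
                 (λ {_ _ _ _ _} → refl) p₁ p₂ (1/ (D * D)) R N ⟩
      441 * 1/ (D * D) * R + X * (D * 1/ (D * D)) * N - 441 * 1/ (D * D)
        ≡⟨ cong (λ z → 441 * 1/ (D * D) * R + X * z * N - 441 * 1/ (D * D)) (sym 1/D≡) ⟩
      441 * 1/ (D * D) * R + X * 1/ D * N - 441 * 1/ (D * D) ∎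
      where
        1/D≡ : 1/ D ≡ D * 1/ (D * D)
        1/D≡ = begin
          1/ D                               ≡⟨ sym (*-identityʳ (1/ D)) ⟩
          1/ D * 1ℚ                          ≡⟨ cong (1/ D *_) (sym (*-inverseˡ (D * D))) ⟩
          1/ D * (1/ (D * D) * (D * D))      ≡⟨ solve 4 (λ p₁ p₂ w u → w :* (u :* (Dₑ p₁ p₂ :* Dₑ p₁ p₂))
                                                                    := (w :* Dₑ p₁ p₂) :* (Dₑ p₁ p₂ :* u))
                                                        (λ {_ _ _ _} → refl) p₁ p₂ (1/ D) (1/ (D * D)) ⟩
          (1/ D * D) * (D * 1/ (D * D))      ≡⟨ cong (_* (D * 1/ (D * D))) (*-inverseˡ D) ⟩
          1ℚ * (D * 1/ (D * D))              ≡⟨ *-identityˡ _ ⟩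
          D * 1/ (D * D)                     ∎

open Expectation

open import Data.Nat using (ℕ; zero; suc; _∸_)
open import Data.Vec using (Vec; [])
open import Data.List using ([])
open import Data.Fin using (zero)
open import Function.Base using (_∘_)
open import Relation.Binary.PropositionalEquality using (_≡_; sym; trans; cong)

open import Defs

expected-stn : ∀ p₁ p₂ k (stn′ : Vec Dist (suc k ∸ 2) → ℕ) → (∀ ds → HasSTN (chain (suc k) ds) (stn′ ds)) →
               expect p₁ p₂ (suc k ∸ 2) (ℕtoℚ ∘ stn′) ≡ Eₛ p₁ p₂ k
expected-stn p₁ p₂ zero    stn′ has = cong ℕtoℚ (chainGraph-stn [] (stn′ []) (has []))
expected-stn p₁ p₂ (suc m) stn′ has =
  trans (expect-cong p₁ p₂ m (λ ds → cong ℕtoℚ (chain-stn ds (stn′ ds) (has ds))))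
        (trans (stn-step p₁ p₂ m zero) (sym (Eₛ-suc p₁ p₂ m)))

open import Data.Rational using (ℚ; _+_; _*_; _-_; _÷_; _≤_; 0ℚ; 1ℚ)

theorem3p1 : (p₁ p₂ : ℚ) (h₁ : 0ℚ ≤ p₁) (h₂ : 0ℚ ≤ p₂) → p₁ + p₂ ≤ 1ℚ →
    (n : ℕ) → 1 Data.Nat.≤ n →
    (stn : Vec Dist (n ∸ 2) → ℕ) → (∀ ds → HasSTN (chain n ds) (stn ds)) →
    expect p₁ p₂ (n ∸ 2) (λ ds → ℕtoℚ (stn ds))
      ≡ _÷_ 441 ((11 + 4 * p₁ + p₂) * (11 + 4 * p₁ + p₂)) {{den²-nz p₁ p₂ h₁ h₂}} * ((12 + 4 * p₁ + p₂) ^ℚ n)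
        + _÷_ (144 * p₁ + 36 * p₂ - 45) (11 + 4 * p₁ + p₂) {{den-nz p₁ p₂ h₁ h₂}} * ℕtoℚ n
        - _÷_ 441 ((11 + 4 * p₁ + p₂) * (11 + 4 * p₁ + p₂)) {{den²-nz p₁ p₂ h₁ h₂}}
theorem3p1 p₁ p₂ h₁ h₂ _ zero    () stn has
theorem3p1 p₁ p₂ h₁ h₂ _ (suc k) _  stn has =
  divide p₁ p₂ {{den-nz p₁ p₂ h₁ h₂}} {{den²-nz p₁ p₂ h₁ h₂}} _ (ℕtoℚ (suc k)) _
         (trans (cong ((11 + 4 * p₁ + p₂) * (11 + 4 * p₁ + p₂) *_) (expected-stn p₁ p₂ k stn has)) (D²*Eₛ p₁ p₂ k))
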